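{- For every positive integer $n$, the forest record number $R(n,n-1)$ equals the weight $W(n)$ of the symmetric group $\mathbb{S}_n$.
   Context: A rooted forest on $[n]$ is a set of labeled rooted trees whose vertex sets partition $[n]=\{1,\dots,n\}$. A vertex of a rooted forest is a record if its label is the largest on the path from it to the root of its tree (inclusive). $R(n,k)$ is the number of rooted forests on $[n]$ with exactly $k$ records. The reflection length of a permutation $\pi$ is the minimal number of transpositions whose product is $\pi$, and $W(n)=\sum_{\pi\in\mathbb{S}_n}(\text{reflection length of }\pi)$. -}

module Defs where

open import Data.Nat using (ℕ; zero; suc; _+_; _<ᵇ_; _≡ᵇ_)
open import Data.Fin using (Fin; toℕ)
open import Data.Fin.Properties using (_≟_)
open import Data.Bool using (Bool; true; false; _∧_; _∨_; not)
open import Data.Maybe using (Maybe; just; nothing)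
open import Data.List using (List; []; _∷_; map; concatMap; filter; length; allFin; upTo; foldr)
open import Data.Nat.ListAction using (sum)
open import Data.Bool.ListAction using (all; any)
open import Data.Vec using (Vec; lookup; tabulate; toList)
import Data.Vec
import Data.Bool
open import Data.Product using (_×_; _,_)
open import Relation.Nullary.Decidable using (⌊_⌋)
open import Function using (_∘_; id)

-- Labels: vertex i : Fin n stands for label (toℕ i + 1) ∈ [n]; order is preserved.

allVecs : {A : Set} → List A → (n : ℕ) → List (Vec A n)
allVecs xs zero    = Data.Vec.[] ∷ []
allVecs xs (suc n) = concatMap (λ x → map (x Data.Vec.∷_) (allVecs xs n)) xs

iterate : {A : Set} → (A → A) → ℕ → A → A
iterate f zero    a = a
iterate f (suc k) a = f (iterate f k a)

-- Rooted forests on [n], encoded by their parent map: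
-- par v = nothing  means v is a root, par v = just w means w is the parent of v.
-- A parent map is a rooted forest iff it has no cycles, i.e. following
-- parents from any vertex reaches a root (n steps always suffice).

ParentMap : ℕ → Set
ParentMap n = Vec (Maybe (Fin n)) n

step : {n : ℕ} → ParentMap n → Maybe (Fin n) → Maybe (Fin n)
step par nothing  = nothing
step par (just v) = lookup par v

isForest : {n : ℕ} → ParentMap n → Bool
isForest {n} par = all (λ v → isNothing (iterate (step par) n (just v))) (allFin n)
  where
  isNothing : {A : Set} → Maybe A → Bool
  isNothing nothing  = true
  isNothing (just _) = false

isRecord : {n : ℕ} → ParentMap n → Fin n → Bool
isRecord {n} par v = all (λ k → smaller (iterate (step par) (suc k) (just v))) (upTo n)
  where
  smaller : Maybe (Fin n) → Bool
  smaller nothing  = true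
  smaller (just w) = toℕ w <ᵇ toℕ v

records : {n : ℕ} → ParentMap n → ℕ
records {n} par = length (filter (λ v → isRecord par v Data.Bool.≟ true) (allFin n))

allParentMaps : (n : ℕ) → List (ParentMap n)
allParentMaps n = allVecs (nothing ∷ map just (allFin n)) n

R : ℕ → ℕ → ℕ
R n k = length (filter (λ par → (isForest par ∧ (records par ≡ᵇ k)) Data.Bool.≟ true) (allParentMaps n))

Fun : ℕ → Set
Fun n = Vec (Fin n) n

eqFin : {n : ℕ} → Fin n → Fin n → Bool
eqFin i j = ⌊ i ≟ j ⌋

isPerm : {n : ℕ} → Fun n → Bool
isPerm {n} f = all (λ i → all (λ j → not (eqFin (lookup f i) (lookup f j)) ∨ eqFin i j) (allFin n)) (allFin n)

allPerms : (n : ℕ) → List (Fun n)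
allPerms n = filter (λ f → isPerm f Data.Bool.≟ true) (allVecs (allFin n) n)

swap : {n : ℕ} → Fin n → Fin n → Fin n → Fin n
swap i j x with eqFin x i | eqFin x j
... | true  | _     = j
... | false | true  = i
... | false | false = x

transpositions : (n : ℕ) → List (Fin n × Fin n)
transpositions n = concatMap (λ i → map (i ,_) (filter (λ j → (toℕ i <ᵇ toℕ j) Data.Bool.≟ true) (allFin n))) (allFin n)

product : {n : ℕ} → List (Fin n × Fin n) → Fin n → Fin n
product = foldr (λ { (i , j) g → swap i j ∘ g }) id

eqFun : {n : ℕ} → (Fin n → Fin n) → Fun n → Bool
eqFun {n} g f = all (λ x → eqFin (g x) (lookup f x)) (allFin n)

productOf : {n : ℕ} → ℕ → Fun n → Bool
productOf {n} k π = any (λ ts → eqFun (product (toList ts)) π) (allVecs (transpositions n) k)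

-- reflection length: least k with π a product of k transpositions.
-- (The search over k ≤ n always succeeds, since every permutation of [n]
--  is a product of at most n - 1 transpositions.)
reflLen : {n : ℕ} → Fun n → ℕ
reflLen {n} π = search (upTo (suc n))
  where
  search : List ℕ → ℕ
  search []       = n
  search (k ∷ ks) with productOf k π
  ... | true  = k
  ... | false = search ks

W : ℕ → ℕ
W n = sum (map reflLen (allPerms n))

-- Both sides satisfy a(0) = 0 and a(n + 1) = (n + 1) a(n) + n · n!.
--
-- W: the reflection length of a permutation is its defect, n minus its number of cycles.
-- Composing with a transposition changes the defect by at most one, and cutting 0 out of its
-- cycle writes every permutation as a product of that many transpositions.  A permutation of
-- [n + 1] is a permutation of [n] with 0 inserted into a cycle before its image j, which adds
-- 1 to the defect unless j = 0; summing over j gives the recurrence.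
--
-- R: in a forest with exactly n − 1 records the non-record u has a parent p > u, every other
-- vertex has a smaller parent, and the children of u exceed p; conversely these parent maps
-- are forests with that single non-record.  The parents can then be chosen independently, so
-- R(n, n − 1) is a sum over u and p of a product of the numbers of admissible parents, and
-- adding the largest vertex n + 1 gives the same recurrence.

module Submission where

open import Data.Bool using (Bool; true; false; not; T; if_then_else_; _∧_; _∨_)
import Data.Bool as Bool
open import Data.Bool.Properties using (T-∧; T-∨; T-≡; ∧-zeroʳ)
open import Data.Empty using (⊥-elim)
open import Data.Fin using (Fin; zero; suc; toℕ; lift; punchIn; _≟_)
open import Data.Fin.Properties using (suc-injective; toℕ-injective; toℕ<n; punchInᵢ≢i)
open import Data.List using (List; []; _∷_; _++_; map; concatMap; filter; length; tabulate; allFin; upTo; applyUpTo)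
open import Data.List.Membership.Propositional using (_∈_; find; lose)
open import Data.List.Membership.Propositional.Properties
  using (∈-concatMap⁺; ∈-concatMap⁻; ∈-map⁺; ∈-map⁻; ∈-filter⁺; ∈-filter⁻; ∈-allFin; ∈-upTo⁺; ∈-upTo⁻)
open import Data.List.Properties using (map-cong; map-++; map-∘; length-map)
open import Data.List.Relation.Unary.All as All using (All; []; _∷_)
open import Data.List.Relation.Unary.All.Properties using (all⁺; all⁻; ¬All⇒Any¬)
import Data.List.Relation.Unary.All.Properties as All
open import Data.List.Relation.Unary.Any as Any using (here)
open import Data.List.Relation.Unary.Any.Properties using (any⁺; any⁻)
open import Data.Maybe using (Maybe; just; nothing)
open import Data.Maybe.Properties using (just-injective; ≡-dec)
open import Data.Maybe.Relation.Unary.All as Maybe using (just; nothing)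
open import Data.Nat using (ℕ; zero; suc; _+_; _*_; _∸_; _≤_; _<_; _<ᵇ_; _≡ᵇ_; z≤n; s≤s; z<s; s≤s⁻¹; _!)
import Data.Nat as ℕ
import Data.Nat.Properties as ℕₚ
open import Data.Nat.ListAction using (sum)
open import Data.Nat.ListAction.Properties using (sum-++)
open import Data.Nat.Properties
  using ( +-*-semiring; +-commutativeSemigroup; module ≤-Reasoning
        ; _<?_; <ᵇ⇒<; <⇒<ᵇ; ≡ᵇ⇒≡; ≡⇒≡ᵇ
        ; ≤-refl; ≤-reflexive; ≤-trans; <-trans; ≤-<-trans; <-≤-trans; <⇒≤; <⇒≢; >⇒≢; ≤⇒≯; ≮⇒≥; ≤∧≢⇒<
        ; <-irrefl; <-asym; <-cmp; n≤1+n; n<1+n; m≤n⇒m≤1+n; m≤n⇒m<n∨m≡n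
        ; +-identityʳ; +-suc; +-comm; +-assoc; +-mono-≤; +-monoˡ-≤; +-monoʳ-≤
        ; *-identityʳ; *-zeroʳ; *-comm; *-assoc; *-distribˡ-+ )
open import Algebra.Properties.CommutativeSemigroup +-commutativeSemigroup using (x∙yz≈y∙xz; interchange)
open import Algebra.Properties.Semiring.Sum +-*-semiring
  using (sum-syntax; sum-cong-≗; sum-remove; sum-replicate-zero; ∑-distrib-+; *-distribˡ-sum; *-distribʳ-sum)
  renaming (sum to ∑)
open import Data.Product using (∃-syntax; _×_; _,_; proj₁; proj₂)
import Data.Product as Product
open import Data.Sum using (_⊎_; inj₁; inj₂)
open import Data.Unit using (tt)
open import Data.Vec using (Vec; lookup) renaming (_∷_ to _∷ᵛ_; [] to [])
import Data.Vec as Vec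
open import Data.Vec.Functional using (foldr)
open import Data.Vec.Properties using (lookup-map; toList∘fromList; length-toList)
open import Function using (_∘_; id)
open import Function.Bundles using (Equivalence; mk⇔)
open import Function.Definitions using (Injective)
open import Relation.Binary.Definitions using (tri<; tri≈; tri>)
open import Relation.Binary.PropositionalEquality
open import Relation.Nullary using (¬_; Dec; does; yes; no; ¬?; _×-dec_; _→-dec_)
open import Relation.Nullary.Decidable using (T?; dec-true; dec-false; does-⇔; toWitness; fromWitness)

open import Defs

private
  variable
    A B : Set
    f g : A → ℕ
    n : ℕ

T⇒≡true : ∀ {b} → T b → b ≡ true
T⇒≡true = Equivalence.to T-≡

≡true⇒T : ∀ {b} → b ≡ true → T b
≡true⇒T = Equivalence.from T-≡

¬T⇒≡false : ∀ {b} → ¬ T b → b ≡ false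
¬T⇒≡false {true}  ¬t = ⊥-elim (¬t _)
¬T⇒≡false {false} _  = refl

T-ext : ∀ {a b : Bool} → (T a → T b) → (T b → T a) → a ≡ b
T-ext {true}  {true}  _ _ = refl
T-ext {true}  {false} a⇒b _ = ⊥-elim (a⇒b _)
T-ext {false} {true}  _ b⇒a = ⊥-elim (b⇒a _)
T-ext {false} {false} _ _ = refl

<ᵇ-true : ∀ {m n} → m < n → (m <ᵇ n) ≡ true
<ᵇ-true = T⇒≡true ∘ <⇒<ᵇ

<ᵇ-false : ∀ {m n} → n ≤ m → (m <ᵇ n) ≡ false
<ᵇ-false {m} {n} n≤m = ¬T⇒≡false (λ t → ≤⇒≯ n≤m (<ᵇ⇒< m n t))

≡ᵇ-true : ∀ {m n} → m ≡ n → (m ≡ᵇ n) ≡ true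
≡ᵇ-true {m} {n} m≡n = T⇒≡true (≡⇒≡ᵇ m n m≡n)

≡ᵇ-false : ∀ {m n} → m ≢ n → (m ≡ᵇ n) ≡ false
≡ᵇ-false {m} {n} m≢n = ¬T⇒≡false (m≢n ∘ ≡ᵇ⇒≡ m n)

-- Finite sums and products

𝟙 : Bool → ℕ
𝟙 true  = 1
𝟙 false = 0

sumOver : List A → (A → ℕ) → ℕ
sumOver xs f = sum (map f xs)

syntax sumOver xs (λ x → e) = ∑[ x ∈ xs ] e
infixl 10 sumOver

sumOver-cong : ∀ xs → (∀ x → f x ≡ g x) → sumOver xs f ≡ sumOver xs g
sumOver-cong xs f≗g = cong sum (map-cong f≗g xs)

sumOver-++ : ∀ xs ys → sumOver (xs ++ ys) f ≡ sumOver xs f + sumOver ys f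
sumOver-++ {f = f} xs ys = trans (cong sum (map-++ f xs ys)) (sum-++ (map f xs) (map f ys))

sumOver-map : ∀ (h : A → B) xs → sumOver (map h xs) f ≡ sumOver xs (f ∘ h)
sumOver-map h xs = cong sum (sym (map-∘ xs))

sumOver-concatMap : ∀ (h : A → List B) xs → sumOver (concatMap h xs) f ≡ ∑[ x ∈ xs ] sumOver (h x) f
sumOver-concatMap h []       = refl
sumOver-concatMap h (x ∷ xs) =
  trans (sumOver-++ (h x) (concatMap h xs)) (cong (sumOver (h x) _ +_) (sumOver-concatMap h xs))

*-distribˡ-sumOver : ∀ c xs → c * sumOver xs f ≡ ∑[ x ∈ xs ] (c * f x)
*-distribˡ-sumOver c []       = *-zeroʳ c
*-distribˡ-sumOver {f = f} c (x ∷ xs) =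
  trans (*-distribˡ-+ c (f x) _) (cong (c * f x +_) (*-distribˡ-sumOver c xs))

*-distribʳ-sumOver : ∀ c xs → sumOver xs f * c ≡ ∑[ x ∈ xs ] (f x * c)
*-distribʳ-sumOver {f = f} c xs =
  trans (*-comm _ c) (trans (*-distribˡ-sumOver c xs) (sumOver-cong xs (λ x → *-comm c (f x))))

sumOver-+ : ∀ xs → ∑[ x ∈ xs ] (f x + g x) ≡ sumOver xs f + sumOver xs g
sumOver-+ []       = refl
sumOver-+ {f = f} {g = g} (x ∷ xs) = trans (cong (f x + g x +_) (sumOver-+ xs)) (interchange (f x) (g x) _ _)

sumOver-zero : ∀ (xs : List A) → ∑[ x ∈ xs ] 0 ≡ 0
sumOver-zero []       = refl
sumOver-zero (x ∷ xs) = sumOver-zero xs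

sumOver-∑-comm : ∀ {n} xs (h : A → Fin n → ℕ) → ∑[ x ∈ xs ] ∑[ i < n ] h x i ≡ ∑[ i < n ] ∑[ x ∈ xs ] h x i
sumOver-∑-comm {n = n} []       h = sym (sum-replicate-zero n)
sumOver-∑-comm         (x ∷ xs) h =
  trans (cong (∑[ i < _ ] h x i +_) (sumOver-∑-comm xs h)) (sym (∑-distrib-+ (h x) _))

sumOver-tabulate : ∀ {n} (h : Fin n → A) → sumOver (tabulate h) f ≡ ∑[ i < n ] f (h i)
sumOver-tabulate {n = zero}  h = refl
sumOver-tabulate {f = f} {n = suc n} h = cong (f (h zero) +_) (sumOver-tabulate (h ∘ suc))

sumOver-allFin : ∀ n (h : Fin n → ℕ) → ∑[ i ∈ allFin n ] h i ≡ ∑[ i < n ] h i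
sumOver-allFin n h = sumOver-tabulate {f = h} {n = n} (λ i → i)

length-filter : ∀ (P : A → Bool) xs → length (filter (λ x → P x Bool.≟ true) xs) ≡ ∑[ x ∈ xs ] 𝟙 (P x)
length-filter P []       = refl
length-filter P (x ∷ xs) with P x
... | true  = cong suc (length-filter P xs)
... | false = length-filter P xs

sum-map-filter : ∀ (P : A → Bool) (h : A → ℕ) xs →
                 sum (map h (filter (λ x → P x Bool.≟ true) xs)) ≡ ∑[ x ∈ xs ] (𝟙 (P x) * h x)
sum-map-filter P h []       = refl
sum-map-filter P h (x ∷ xs) with P x
... | true  = cong₂ _+_ (sym (+-identityʳ (h x))) (sum-map-filter P h xs)
... | false = sum-map-filter P h xs

∑-const : ∀ n c → ∑[ i < n ] c ≡ n * c
∑-const zero    c = refl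
∑-const (suc n) c = cong (c +_) (∑-const n c)

∑-zero : ∀ {n} (h : Fin n → ℕ) → (∀ i → h i ≡ 0) → ∑ h ≡ 0
∑-zero {n} h h≡0 = trans (sum-cong-≗ h≡0) (sum-replicate-zero n)

∑-single : ∀ {n} (h : Fin n → ℕ) j → (∀ i → i ≢ j → h i ≡ 0) → ∑ h ≡ h j
∑-single {suc n} h j h≡0 = begin
  ∑ h                               ≡⟨ sum-remove h ⟩
  h j + ∑[ k < n ] h (punchIn j k)  ≡⟨ cong (h j +_) (∑-zero _ (λ k → h≡0 _ (punchInᵢ≢i j k))) ⟩
  h j + 0                           ≡⟨ +-identityʳ (h j) ⟩
  h j                               ∎
  where open ≡-Reasoning

∑-exchange : ∀ {n} (h h′ : Fin n → ℕ) j → (∀ i → i ≢ j → h i ≡ h′ i) → h′ j + ∑ h ≡ h j + ∑ h′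
∑-exchange {suc n} h h′ j h≡h′ = begin
  h′ j + ∑ h                                  ≡⟨ cong (h′ j +_) (sum-remove h) ⟩
  h′ j + (h j + ∑[ k < n ] h (punchIn j k))   ≡⟨ x∙yz≈y∙xz (h′ j) (h j) _ ⟩
  h j + (h′ j + ∑[ k < n ] h (punchIn j k))   ≡⟨ cong (λ s → h j + (h′ j + s)) rest ⟩
  h j + (h′ j + ∑[ k < n ] h′ (punchIn j k))  ≡⟨ cong (h j +_) (sum-remove h′) ⟨
  h j + ∑ h′                                  ∎
  where
  open ≡-Reasoning
  rest : ∑[ k < n ] h (punchIn j k) ≡ ∑[ k < n ] h′ (punchIn j k)
  rest = sum-cong-≗ (λ k → h≡h′ _ (punchInᵢ≢i j k))

∑-toℕ-last : ∀ n (h : ℕ → ℕ) → ∑[ i < suc n ] h (toℕ i) ≡ ∑[ i < n ] h (toℕ i) + h n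
∑-toℕ-last zero    h = +-comm (h 0) 0
∑-toℕ-last (suc n) h = trans (cong (h 0 +_) (∑-toℕ-last n (h ∘ suc))) (sym (+-assoc (h 0) _ _))

count-< : ∀ {N} v → v ≤ N → ∑[ w < N ] 𝟙 (toℕ w <ᵇ v) ≡ v
count-< {zero}  zero    z≤n        = refl
count-< {suc N} zero    _          = ∑-zero {suc N} (λ w → 𝟙 (toℕ w <ᵇ 0)) (λ _ → refl)
count-< {suc N} (suc v) (s≤s v≤N) = cong suc (count-< v v≤N)

parentOptions : ∀ N → List (Maybe (Fin N))
parentOptions N = nothing ∷ map just (allFin N)

∑𝟙≤n : ∀ {n} (c : Fin n → Bool) → ∑[ i < n ] 𝟙 (c i) ≤ n
∑𝟙≤n {zero}  c = z≤n
∑𝟙≤n {suc n} c with c zero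
... | true  = s≤s (∑𝟙≤n (c ∘ suc))
... | false = m≤n⇒m≤1+n (∑𝟙≤n (c ∘ suc))

∑𝟙≡n⇒all : ∀ {n} (c : Fin n → Bool) → ∑[ i < n ] 𝟙 (c i) ≡ n → ∀ i → T (c i)
∑𝟙≡n⇒all {suc n} c eq i with c zero in c₀
∑𝟙≡n⇒all {suc n} c eq zero    | true  rewrite c₀ = tt
∑𝟙≡n⇒all {suc n} c eq (suc i) | true  = ∑𝟙≡n⇒all (c ∘ suc) (ℕₚ.suc-injective eq) i
... | false = ⊥-elim (<-irrefl eq (s≤s (∑𝟙≤n (c ∘ suc))))

exactlyOneFalse : ∀ {m} (c : Fin (suc m) → Bool) → ∑[ i < suc m ] 𝟙 (c i) ≡ m →
                  ∃[ u ] ¬ T (c u) × (∀ v → v ≢ u → T (c v))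
exactlyOneFalse {m} c eq with c zero in c₀
exactlyOneFalse {zero}  c () | true
exactlyOneFalse {suc m} c eq | true with exactlyOneFalse (c ∘ suc) (ℕₚ.suc-injective eq)
... | u , ¬cu , cv = suc u , ¬cu , λ where
  zero    _   → subst T (sym c₀) tt
  (suc v) v≢u → cv v (v≢u ∘ cong suc)
exactlyOneFalse c eq | false = zero , subst (¬_ ∘ T) (sym c₀) (λ ()) , λ where
  zero    0≢0 → ⊥-elim (0≢0 refl)
  (suc v) _   → ∑𝟙≡n⇒all (c ∘ suc) eq v

exactlyOneFalse⁻ : ∀ {m} (c : Fin (suc m) → Bool) u → ¬ T (c u) → (∀ v → v ≢ u → T (c v)) →
                   ∑[ i < suc m ] 𝟙 (c i) ≡ m
exactlyOneFalse⁻ {m} c u ¬cu cv = ℕₚ.suc-injective (begin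
  suc (∑[ i < suc m ] 𝟙 (c i))  ≡⟨ ∑-exchange (𝟙 ∘ c) (λ _ → 1) u (λ v v≢u → 𝟙-true (cv v v≢u)) ⟩
  𝟙 (c u) + ∑[ i < suc m ] 1    ≡⟨ cong₂ _+_ (𝟙-false ¬cu) (trans (∑-const (suc m) 1) (*-identityʳ (suc m))) ⟩
  suc m                         ∎)
  where
  open ≡-Reasoning
  𝟙-true : ∀ {b} → T b → 𝟙 b ≡ 1
  𝟙-true {true} _ = refl
  𝟙-false : ∀ {b} → ¬ T b → 𝟙 b ≡ 0
  𝟙-false {true}  ¬t = ⊥-elim (¬t tt)
  𝟙-false {false} _  = refl

∏ : ∀ {n} → (Fin n → ℕ) → ℕ
∏ = foldr _*_ 1

prod-syntax : ∀ n → (Fin n → ℕ) → ℕ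
prod-syntax _ = ∏

infixl 10 prod-syntax
syntax prod-syntax n (λ i → e) = ∏[ i < n ] e

∏-cong : ∀ {n} {h h′ : Fin n → ℕ} → (∀ i → h i ≡ h′ i) → ∏ h ≡ ∏ h′
∏-cong {zero}  h≗h′ = refl
∏-cong {suc n} h≗h′ = cong₂ _*_ (h≗h′ zero) (∏-cong (h≗h′ ∘ suc))

∏-toℕ-last : ∀ n (h : ℕ → ℕ) → ∏[ i < suc n ] h (toℕ i) ≡ ∏[ i < n ] h (toℕ i) * h n
∏-toℕ-last zero    h = trans (*-identityʳ (h 0)) (sym (+-identityʳ (h 0)))
∏-toℕ-last (suc n) h = trans (cong (h 0 *_) (∏-toℕ-last n (h ∘ suc))) (sym (*-assoc (h 0) _ _))

∏-suc : ∀ K → ∏[ v < K ] suc (toℕ v) ≡ K !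
∏-suc zero    = refl
∏-suc (suc K) = trans (∏-toℕ-last K suc) (trans (cong (_* suc K) (∏-suc K)) (*-comm (K !) (suc K)))

∏-𝟙-all : ∀ {n} {P : Fin n → Set} (P? : ∀ i → Dec (P i)) → (∀ i → P i) → ∏[ i < n ] 𝟙 (does (P? i)) ≡ 1
∏-𝟙-all {zero}  P? all = refl
∏-𝟙-all {suc n} P? all rewrite dec-true (P? zero) (all zero) = trans (+-identityʳ _) (∏-𝟙-all (P? ∘ suc) (all ∘ suc))

∏-𝟙-¬all : ∀ {n} {P : Fin n → Set} (P? : ∀ i → Dec (P i)) → ¬ (∀ i → P i) → ∏[ i < n ] 𝟙 (does (P? i)) ≡ 0
∏-𝟙-¬all {zero}  P? ¬all = ⊥-elim (¬all (λ ()))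
∏-𝟙-¬all {suc n} P? ¬all with P? zero
... | no  ¬p₀ = refl
... | yes p₀  = trans (+-identityʳ _) (∏-𝟙-¬all (P? ∘ suc) (λ all → ¬all (λ where zero → p₀; (suc i) → all i)))

sumOver-allVecs-suc : ∀ xs n (F : Vec A (suc n) → ℕ) →
                      sumOver (allVecs xs (suc n)) F ≡ ∑[ x ∈ xs ] ∑[ w ∈ allVecs xs n ] F (x ∷ᵛ w)
sumOver-allVecs-suc xs n F =
  trans (sumOver-concatMap _ xs) (sumOver-cong xs (λ x → sumOver-map (x ∷ᵛ_) (allVecs xs n)))

sumOver-allVecs-cong : ∀ (xs ys : List A) → (∀ (h : A → ℕ) → sumOver xs h ≡ sumOver ys h) →
                       ∀ n (F : Vec A n → ℕ) → sumOver (allVecs xs n) F ≡ sumOver (allVecs ys n) F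
sumOver-allVecs-cong xs ys xs≈ys zero    F = refl
sumOver-allVecs-cong xs ys xs≈ys (suc n) F = begin
  sumOver (allVecs xs (suc n)) F                ≡⟨ sumOver-allVecs-suc xs n F ⟩
  ∑[ x ∈ xs ] ∑[ w ∈ allVecs xs n ] F (x ∷ᵛ w)  ≡⟨ sumOver-cong xs (λ x → sumOver-allVecs-cong xs ys xs≈ys n (F ∘ (x ∷ᵛ_))) ⟩
  ∑[ x ∈ xs ] ∑[ w ∈ allVecs ys n ] F (x ∷ᵛ w)  ≡⟨ xs≈ys _ ⟩
  ∑[ y ∈ ys ] ∑[ w ∈ allVecs ys n ] F (y ∷ᵛ w)  ≡⟨ sumOver-allVecs-suc ys n F ⟨
  sumOver (allVecs ys (suc n)) F                ∎
  where open ≡-Reasoning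

sumOver-allVecs-drop : ∀ (a : A) xs n (F : Vec A n → ℕ) → (∀ w i → lookup w i ≡ a → F w ≡ 0) →
                       sumOver (allVecs (a ∷ xs) n) F ≡ sumOver (allVecs xs n) F
sumOver-allVecs-drop a xs zero    F F≡0 = refl
sumOver-allVecs-drop a xs (suc n) F F≡0 = begin
  sumOver (allVecs (a ∷ xs) (suc n)) F
    ≡⟨ sumOver-allVecs-suc (a ∷ xs) n F ⟩
  ∑[ w ∈ allVecs (a ∷ xs) n ] F (a ∷ᵛ w) + ∑[ x ∈ xs ] ∑[ w ∈ allVecs (a ∷ xs) n ] F (x ∷ᵛ w)
    ≡⟨ cong₂ _+_ (trans (sumOver-cong (allVecs (a ∷ xs) n) (λ w → F≡0 (a ∷ᵛ w) zero refl))
                        (sumOver-zero (allVecs (a ∷ xs) n)))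
                 (sumOver-cong xs (λ x → sumOver-allVecs-drop a xs n (F ∘ (x ∷ᵛ_)) (λ w i → F≡0 (x ∷ᵛ w) (suc i)))) ⟩
  ∑[ x ∈ xs ] ∑[ w ∈ allVecs xs n ] F (x ∷ᵛ w)
    ≡⟨ sumOver-allVecs-suc xs n F ⟨
  sumOver (allVecs xs (suc n)) F
    ∎
  where open ≡-Reasoning

sumOver-allVecs-map : ∀ (h : A → B) xs n (F : Vec B n → ℕ) →
                      sumOver (allVecs (map h xs) n) F ≡ ∑[ w ∈ allVecs xs n ] F (Vec.map h w)
sumOver-allVecs-map h xs zero    F = refl
sumOver-allVecs-map h xs (suc n) F = begin
  sumOver (allVecs (map h xs) (suc n)) F                            ≡⟨ sumOver-allVecs-suc (map h xs) n F ⟩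
  ∑[ y ∈ map h xs ] ∑[ w ∈ allVecs (map h xs) n ] F (y ∷ᵛ w)        ≡⟨ sumOver-map h xs ⟩
  ∑[ x ∈ xs ] ∑[ w ∈ allVecs (map h xs) n ] F (h x ∷ᵛ w)            ≡⟨ sumOver-cong xs (λ x → sumOver-allVecs-map h xs n (F ∘ (h x ∷ᵛ_))) ⟩
  ∑[ x ∈ xs ] ∑[ w ∈ allVecs xs n ] F (h x ∷ᵛ Vec.map h w)     ≡⟨ sumOver-allVecs-suc xs n _ ⟨
  ∑[ w ∈ allVecs xs (suc n) ] F (Vec.map h w)                  ∎
  where open ≡-Reasoning

sumOver-allVecs-∏ : ∀ (xs : List A) n (h : Fin n → A → ℕ) →
                    ∑[ w ∈ allVecs xs n ] ∏[ i < n ] h i (lookup w i) ≡ ∏[ i < n ] ∑[ x ∈ xs ] h i x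
sumOver-allVecs-∏ xs zero    h = refl
sumOver-allVecs-∏ xs (suc n) h = begin
  ∑[ w ∈ allVecs xs (suc n) ] ∏[ i < suc n ] h i (lookup w i)
    ≡⟨ sumOver-allVecs-suc xs n _ ⟩
  ∑[ x ∈ xs ] ∑[ w ∈ allVecs xs n ] (h zero x * ∏[ i < n ] h (suc i) (lookup w i))
    ≡⟨ sumOver-cong xs (λ x → *-distribˡ-sumOver (h zero x) (allVecs xs n)) ⟨
  ∑[ x ∈ xs ] (h zero x * ∑[ w ∈ allVecs xs n ] ∏[ i < n ] h (suc i) (lookup w i))
    ≡⟨ sumOver-cong xs (λ x → cong (h zero x *_) (sumOver-allVecs-∏ xs n (h ∘ suc))) ⟩
  ∑[ x ∈ xs ] (h zero x * ∏[ i < n ] ∑[ y ∈ xs ] h (suc i) y)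
    ≡⟨ *-distribʳ-sumOver _ xs ⟨
  ∑[ x ∈ xs ] h zero x * ∏[ i < n ] ∑[ y ∈ xs ] h (suc i) y
    ∎
  where open ≡-Reasoning

-- Transpositions and the defect of a permutation

eqFin-≡ : ∀ {i j : Fin n} → i ≡ j → eqFin i j ≡ true
eqFin-≡ {i = i} {j} i≡j with i ≟ j
... | yes _   = refl
... | no  i≢j = ⊥-elim (i≢j i≡j)

eqFin-≢ : ∀ {i j : Fin n} → i ≢ j → eqFin i j ≡ false
eqFin-≢ {i = i} {j} i≢j with i ≟ j
... | yes i≡j = ⊥-elim (i≢j i≡j)
... | no  _   = refl

-- Case splits go through this rather than `x ≟ i`, which `with` would also abstract inside `swap`.
≡⊎≢ : (x y : Fin n) → x ≡ y ⊎ x ≢ y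
≡⊎≢ x y with x ≟ y
... | yes x≡y = inj₁ x≡y
... | no  x≢y = inj₂ x≢y

swap-≡ˡ : ∀ (i j : Fin n) → swap i j i ≡ j
swap-≡ˡ i j rewrite eqFin-≡ (refl {x = i}) = refl

swap-≡ʳ : ∀ (i j : Fin n) → swap i j j ≡ i
swap-≡ʳ i j with j ≟ i
... | yes j≡i = j≡i
... | no  _   rewrite eqFin-≡ (refl {x = j}) = refl

swap-≢ : ∀ {i j x : Fin n} → x ≢ i → x ≢ j → swap i j x ≡ x
swap-≢ x≢i x≢j rewrite eqFin-≢ x≢i | eqFin-≢ x≢j = refl

swap-involutive : ∀ (i j x : Fin n) → swap i j (swap i j x) ≡ x
swap-involutive i j x with ≡⊎≢ x i | ≡⊎≢ x j
... | inj₁ refl | _        = trans (cong (swap x j) (swap-≡ˡ x j)) (swap-≡ʳ x j)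
... | inj₂ _    | inj₁ refl = trans (cong (swap i x) (swap-≡ʳ i x)) (swap-≡ˡ i x)
... | inj₂ x≢i  | inj₂ x≢j  = trans (cong (swap i j) (swap-≢ x≢i x≢j)) (swap-≢ x≢i x≢j)

swap-comm : ∀ (i j x : Fin n) → swap i j x ≡ swap j i x
swap-comm i j x with ≡⊎≢ x i | ≡⊎≢ x j
... | inj₁ refl | _        = trans (swap-≡ˡ x j) (sym (swap-≡ʳ j x))
... | inj₂ _    | inj₁ refl = trans (swap-≡ʳ i x) (sym (swap-≡ˡ x i))
... | inj₂ x≢i  | inj₂ x≢j  = trans (swap-≢ x≢i x≢j) (sym (swap-≢ x≢j x≢i))

swap-injective : ∀ (i j : Fin n) → Injective _≡_ _≡_ (swap i j)
swap-injective i j {x} {y} eq =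
  trans (sym (swap-involutive i j x)) (trans (cong (swap i j) eq) (swap-involutive i j y))

swap-conj : ∀ {m} {σ : Fin m → Fin n} → Injective _≡_ _≡_ σ → ∀ a b x → swap (σ a) (σ b) (σ x) ≡ σ (swap a b x)
swap-conj {σ = σ} σ-inj a b x with ≡⊎≢ x a | ≡⊎≢ x b
... | inj₁ refl | _        = trans (swap-≡ˡ (σ x) (σ b)) (cong σ (sym (swap-≡ˡ x b)))
... | inj₂ _    | inj₁ refl = trans (swap-≡ʳ (σ a) (σ x)) (cong σ (sym (swap-≡ʳ a x)))
... | inj₂ x≢a  | inj₂ x≢b  = trans (swap-≢ (x≢a ∘ σ-inj) (x≢b ∘ σ-inj)) (cong σ (sym (swap-≢ x≢a x≢b)))

swap-lift : ∀ (i j : Fin n) (g : Fin n → Fin n) x → swap (suc i) (suc j) (lift 1 g x) ≡ lift 1 (swap i j ∘ g) x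
swap-lift i j g zero    = swap-≢ {i = suc i} {suc j} (λ ()) (λ ())
swap-lift i j g (suc x) = swap-conj suc-injective i j (g x)

swap-self : ∀ (i x : Fin n) → swap i i x ≡ x
swap-self i x with ≡⊎≢ x i
... | inj₁ refl = swap-≡ˡ x x
... | inj₂ x≢i  = swap-≢ x≢i x≢i

swap-braid : ∀ {a b c : Fin n} → a ≢ b → a ≢ c → b ≢ c → ∀ x → swap a c (swap a b x) ≡ swap c b (swap a c x)
swap-braid {a = a} {b} {c} a≢b a≢c b≢c x with ≡⊎≢ x a | ≡⊎≢ x b | ≡⊎≢ x c
... | inj₁ refl | _         | _         = begin
  swap x c (swap x b x)  ≡⟨ cong (swap x c) (swap-≡ˡ x b) ⟩
  swap x c b             ≡⟨ swap-≢ (a≢b ∘ sym) b≢c ⟩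
  b                      ≡⟨ swap-≡ˡ c b ⟨
  swap c b c             ≡⟨ cong (swap c b) (swap-≡ˡ x c) ⟨
  swap c b (swap x c x)  ∎
  where open ≡-Reasoning
... | inj₂ _    | inj₁ refl | _         = begin
  swap a c (swap a x x)  ≡⟨ cong (swap a c) (swap-≡ʳ a x) ⟩
  swap a c a             ≡⟨ swap-≡ˡ a c ⟩
  c                      ≡⟨ swap-≡ʳ c x ⟨
  swap c x x             ≡⟨ cong (swap c x) (swap-≢ (a≢b ∘ sym) b≢c) ⟨
  swap c x (swap a c x)  ∎
  where open ≡-Reasoning
... | inj₂ x≢a  | inj₂ x≢b  | inj₁ refl = begin
  swap a x (swap a b x)  ≡⟨ cong (swap a x) (swap-≢ x≢a x≢b) ⟩
  swap a x x             ≡⟨ swap-≡ʳ a x ⟩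
  a                      ≡⟨ swap-≢ a≢c a≢b ⟨
  swap x b a             ≡⟨ cong (swap x b) (swap-≡ʳ a x) ⟨
  swap x b (swap a x x)  ∎
  where open ≡-Reasoning
... | inj₂ x≢a  | inj₂ x≢b  | inj₂ x≢c  = begin
  swap a c (swap a b x)  ≡⟨ cong (swap a c) (swap-≢ x≢a x≢b) ⟩
  swap a c x             ≡⟨ swap-≢ x≢a x≢c ⟩
  x                      ≡⟨ swap-≢ x≢c x≢b ⟨
  swap c b x             ≡⟨ cong (swap c b) (swap-≢ x≢a x≢c) ⟨
  swap c b (swap a c x)  ∎
  where open ≡-Reasoning

-- remove0 f cuts 0 out of its cycle and relabels x + 1 as x: for injective f it is the
-- restriction of swap zero (f zero) ∘ f, which fixes 0 (suc-remove0).  The last clause of cut0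
-- is only reached when f is not injective.
cut0 : Fin (suc n) → Fin (suc n) → Fin n → Fin n
cut0 (suc y) _       _ = y
cut0 zero    (suc y) _ = y
cut0 zero    zero    x = x

remove0 : (Fin (suc n) → Fin (suc n)) → Fin n → Fin n
remove0 f x = cut0 (f (suc x)) (f zero) x

zero⊎suc : (y : Fin (suc n)) → y ≡ zero ⊎ ∃[ k ] y ≡ suc k
zero⊎suc zero    = inj₁ refl
zero⊎suc (suc k) = inj₂ (k , refl)

nonZero : Fin (suc n) → ℕ
nonZero zero    = 0
nonZero (suc _) = 1

-- For a permutation f this is n minus the number of cycles of f.
defect : ∀ n → (Fin n → Fin n) → ℕ
defect zero    f = 0
defect (suc n) f = nonZero (f zero) + defect n (remove0 f)

remove0-cong : {f g : Fin (suc n) → Fin (suc n)} → f ≗ g → remove0 f ≗ remove0 g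
remove0-cong f≗g x = cong₂ (λ a b → cut0 a b x) (f≗g (suc x)) (f≗g zero)

defect-cong : ∀ n {f g : Fin n → Fin n} → f ≗ g → defect n f ≡ defect n g
defect-cong zero    f≗g = refl
defect-cong (suc n) f≗g = cong₂ _+_ (cong nonZero (f≗g zero)) (defect-cong n (remove0-cong f≗g))

defect-id : ∀ n → defect n id ≡ 0
defect-id zero    = refl
defect-id (suc n) = defect-id n

defect≤n : ∀ n f → defect n f ≤ n
defect≤n zero    f = z≤n
defect≤n (suc n) f = +-mono-≤ (nonZero≤1 (f zero)) (defect≤n n (remove0 f))
  where
  nonZero≤1 : (y : Fin (suc n)) → nonZero y ≤ 1
  nonZero≤1 zero    = z≤n
  nonZero≤1 (suc _) = ≤-refl

suc-remove0 : {f : Fin (suc n) → Fin (suc n)} → Injective _≡_ _≡_ f →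
              ∀ x → suc (remove0 f x) ≡ swap zero (f zero) (f (suc x))
suc-remove0 {f = f} f-inj x with f (suc x) in fx | f zero in f0
... | suc y | z      = sym (swap-≢ {i = zero} (λ ()) (λ y≡z → 0≢1+ (f-inj (trans f0 (trans (sym y≡z) (sym fx))))))
  where 0≢1+ : zero ≢ suc x
        0≢1+ ()
... | zero  | suc z  = sym (swap-≡ˡ zero (suc z))
... | zero  | zero   with () ← f-inj (trans fx (sym f0))

remove0-injective : {f : Fin (suc n) → Fin (suc n)} → Injective _≡_ _≡_ f → Injective _≡_ _≡_ (remove0 f)
remove0-injective {f = f} f-inj {x} {y} eq =
  suc-injective (f-inj (swap-injective zero (f zero) (begin
    swap zero (f zero) (f (suc x))  ≡⟨ suc-remove0 f-inj x ⟨
    suc (remove0 f x)               ≡⟨ cong suc eq ⟩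
    suc (remove0 f y)               ≡⟨ suc-remove0 f-inj y ⟩
    swap zero (f zero) (f (suc y))  ∎)))
  where open ≡-Reasoning

swap∘lift-remove0 : {f : Fin (suc n) → Fin (suc n)} → Injective _≡_ _≡_ f →
                    ∀ x → swap zero (f zero) (lift 1 (remove0 f) x) ≡ f x
swap∘lift-remove0 {f = f} f-inj zero    = swap-≡ˡ zero (f zero)
swap∘lift-remove0 {f = f} f-inj (suc x) =
  trans (cong (swap zero (f zero)) (suc-remove0 f-inj x)) (swap-involutive zero (f zero) (f (suc x)))

∘-injective : ∀ {f g : Fin n → Fin n} → Injective _≡_ _≡_ f → Injective _≡_ _≡_ g → Injective _≡_ _≡_ (f ∘ g)
∘-injective f-inj g-inj = g-inj ∘ f-inj

nonZero-swap-suc : ∀ (i j : Fin n) y → nonZero (swap (suc i) (suc j) y) ≡ nonZero y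
nonZero-swap-suc i j zero    = cong nonZero (swap-≢ {i = suc i} {suc j} (λ ()) (λ ()))
nonZero-swap-suc i j (suc y) = cong nonZero (swap-conj suc-injective i j y)

remove0-swap-suc : ∀ {f : Fin (suc n) → Fin (suc n)} → Injective _≡_ _≡_ f → ∀ i j x →
                   remove0 (swap (suc i) (suc j) ∘ f) x ≡ swap i j (remove0 f x)
remove0-swap-suc {f = f} f-inj i j x = suc-injective (begin
  suc (remove0 (σ ∘ f) x)                     ≡⟨ suc-remove0 (∘-injective (swap-injective _ _) f-inj) x ⟩
  swap zero (σ (f zero)) (σ (f (suc x)))      ≡⟨ cong (λ z → swap z (σ (f zero)) (σ (f (suc x)))) σ0 ⟨
  swap (σ zero) (σ (f zero)) (σ (f (suc x)))  ≡⟨ swap-conj (swap-injective _ _) zero (f zero) (f (suc x)) ⟩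
  σ (swap zero (f zero) (f (suc x)))          ≡⟨ cong σ (suc-remove0 f-inj x) ⟨
  σ (suc (remove0 f x))                       ≡⟨ swap-conj suc-injective i j (remove0 f x) ⟩
  suc (swap i j (remove0 f x))                ∎)
  where
  open ≡-Reasoning
  σ = swap (suc i) (suc j)
  σ0 : σ zero ≡ zero
  σ0 = swap-≢ {i = suc i} {suc j} (λ ()) (λ ())

module _ {f : Fin (suc n) → Fin (suc n)} (f-inj : Injective _≡_ _≡_ f) (j : Fin n) where
  private
    τ = swap zero (suc j)

    suc-remove0-τ : ∀ x → suc (remove0 (τ ∘ f) x) ≡ swap zero (τ (f zero)) (τ (f (suc x)))
    suc-remove0-τ = suc-remove0 (∘-injective (swap-injective _ _) f-inj)

  remove0-swap0-fixed : f zero ≡ zero → ∀ x → remove0 (τ ∘ f) x ≡ remove0 f x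
  remove0-swap0-fixed f0 x = suc-injective (begin
    suc (remove0 (τ ∘ f) x)                 ≡⟨ suc-remove0-τ x ⟩
    swap zero (τ (f zero)) (τ (f (suc x)))  ≡⟨ cong (λ z → swap zero (τ z) (τ (f (suc x)))) f0 ⟩
    swap zero (τ zero) (τ (f (suc x)))      ≡⟨ cong (λ z → swap zero z (τ (f (suc x)))) (swap-≡ˡ zero (suc j)) ⟩
    τ (τ (f (suc x)))                       ≡⟨ swap-involutive zero (suc j) (f (suc x)) ⟩
    f (suc x)                               ≡⟨ swap-self zero (f (suc x)) ⟨
    swap zero zero (f (suc x))              ≡⟨ cong (λ z → swap zero z (f (suc x))) f0 ⟨
    swap zero (f zero) (f (suc x))          ≡⟨ suc-remove0 f-inj x ⟨
    suc (remove0 f x)                       ∎)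
    where open ≡-Reasoning

  remove0-swap0-partner : f zero ≡ suc j → ∀ x → remove0 (τ ∘ f) x ≡ remove0 f x
  remove0-swap0-partner f0 x = suc-injective (begin
    suc (remove0 (τ ∘ f) x)                 ≡⟨ suc-remove0-τ x ⟩
    swap zero (τ (f zero)) (τ (f (suc x)))  ≡⟨ cong (λ z → swap zero (τ z) (τ (f (suc x)))) f0 ⟩
    swap zero (τ (suc j)) (τ (f (suc x)))   ≡⟨ cong (λ z → swap zero z (τ (f (suc x)))) (swap-≡ʳ zero (suc j)) ⟩
    swap zero zero (τ (f (suc x)))          ≡⟨ swap-self zero _ ⟩
    τ (f (suc x))                           ≡⟨ cong (λ z → swap zero z (f (suc x))) f0 ⟨
    swap zero (f zero) (f (suc x))          ≡⟨ suc-remove0 f-inj x ⟨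
    suc (remove0 f x)                       ∎)
    where open ≡-Reasoning

  remove0-swap0-other : ∀ {k} → k ≢ j → f zero ≡ suc k → ∀ x → remove0 (τ ∘ f) x ≡ swap k j (remove0 f x)
  remove0-swap0-other {k} k≢j f0 x = suc-injective (begin
    suc (remove0 (τ ∘ f) x)                 ≡⟨ suc-remove0-τ x ⟩
    swap zero (τ (f zero)) (τ (f (suc x)))  ≡⟨ cong (λ z → swap zero (τ z) (τ (f (suc x)))) f0 ⟩
    swap zero (τ (suc k)) (τ (f (suc x)))   ≡⟨ cong (λ z → swap zero z (τ (f (suc x)))) τk ⟩
    swap zero (suc k) (τ (f (suc x)))       ≡⟨ swap-braid (λ ()) (λ ()) (k≢j ∘ sym ∘ suc-injective) (f (suc x)) ⟩
    swap (suc k) (suc j) (swap zero (suc k) (f (suc x)))  ≡⟨ cong (λ z → swap (suc k) (suc j) (swap zero z (f (suc x)))) f0 ⟨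
    swap (suc k) (suc j) (swap zero (f zero) (f (suc x))) ≡⟨ cong (swap (suc k) (suc j)) (suc-remove0 f-inj x) ⟨
    swap (suc k) (suc j) (suc (remove0 f x))              ≡⟨ swap-conj suc-injective k j (remove0 f x) ⟩
    suc (swap k j (remove0 f x))            ∎)
    where
    open ≡-Reasoning
    τk : τ (suc k) ≡ suc k
    τk = swap-≢ {i = zero} (λ ()) (k≢j ∘ suc-injective)

defect-swap : ∀ n {f : Fin n → Fin n} → Injective _≡_ _≡_ f → ∀ {i j} → i ≢ j →
              defect n (swap i j ∘ f) ≤ suc (defect n f)

defect-swap0 : ∀ n {f : Fin (suc n) → Fin (suc n)} → Injective _≡_ _≡_ f → ∀ j →
               defect (suc n) (swap zero (suc j) ∘ f) ≤ suc (defect (suc n) f)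
defect-swap0 n {f} f-inj j with zero⊎suc (f zero)
... | inj₁ f0 = begin
  nonZero (τ (f zero)) + defect n (remove0 (τ ∘ f))
    ≡⟨ cong₂ _+_ (cong (nonZero ∘ τ) f0) (defect-cong n (remove0-swap0-fixed f-inj j f0)) ⟩
  suc (defect n (remove0 f))
    ≡⟨ cong (λ y → suc (nonZero y + defect n (remove0 f))) f0 ⟨
  suc (defect (suc n) f)
    ∎
  where
  open ≤-Reasoning
  τ = swap zero (suc j)
... | inj₂ (k , f0) with ≡⊎≢ k j
...   | inj₁ refl = begin
  nonZero (τ (f zero)) + defect n (remove0 (τ ∘ f))
    ≡⟨ cong₂ _+_ (cong nonZero (trans (cong τ f0) (swap-≡ʳ zero (suc k)))) (defect-cong n (remove0-swap0-partner f-inj k f0)) ⟩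
  defect n (remove0 f)
    ≤⟨ m≤n⇒m≤1+n (n≤1+n _) ⟩
  suc (suc (defect n (remove0 f)))
    ≡⟨ cong (λ y → suc (nonZero y + defect n (remove0 f))) f0 ⟨
  suc (defect (suc n) f)
    ∎
  where
  open ≤-Reasoning
  τ = swap zero (suc k)
...   | inj₂ k≢j = begin
  nonZero (τ (f zero)) + defect n (remove0 (τ ∘ f))
    ≡⟨ cong₂ _+_ (cong nonZero (trans (cong τ f0) (swap-≢ {i = zero} (λ ()) (k≢j ∘ suc-injective))))
                 (defect-cong n (remove0-swap0-other f-inj j k≢j f0)) ⟩
  suc (defect n (swap k j ∘ remove0 f))
    ≤⟨ s≤s (defect-swap n (remove0-injective f-inj) k≢j) ⟩
  suc (suc (defect n (remove0 f)))
    ≡⟨ cong (λ y → suc (nonZero y + defect n (remove0 f))) f0 ⟨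
  suc (defect (suc n) f)
    ∎
  where
  open ≤-Reasoning
  τ = swap zero (suc j)

defect-swap zero    f-inj {()}
defect-swap (suc n) f-inj {zero}  {zero}  0≢0 = ⊥-elim (0≢0 refl)
defect-swap (suc n) f-inj {zero}  {suc j} _   = defect-swap0 n f-inj j
defect-swap (suc n) {f} f-inj {suc i} {zero} _ = begin
  defect (suc n) (swap (suc i) zero ∘ f)  ≡⟨ defect-cong (suc n) (λ x → swap-comm (suc i) zero (f x)) ⟩
  defect (suc n) (swap zero (suc i) ∘ f)  ≤⟨ defect-swap0 n f-inj i ⟩
  suc (defect (suc n) f)                  ∎
  where open ≤-Reasoning
defect-swap (suc n) {f} f-inj {suc i} {suc j} i≢j = begin
  nonZero (swap (suc i) (suc j) (f zero)) + defect n (remove0 (swap (suc i) (suc j) ∘ f))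
    ≡⟨ cong₂ _+_ (nonZero-swap-suc i j (f zero)) (defect-cong n (remove0-swap-suc f-inj i j)) ⟩
  nonZero (f zero) + defect n (swap i j ∘ remove0 f)
    ≤⟨ +-monoʳ-≤ (nonZero (f zero)) (defect-swap n (remove0-injective f-inj) (i≢j ∘ cong suc)) ⟩
  nonZero (f zero) + suc (defect n (remove0 f))
    ≡⟨ +-suc (nonZero (f zero)) _ ⟩
  suc (defect (suc n) f)
    ∎
  where open ≤-Reasoning

product-injective : ∀ (ts : List (Fin n × Fin n)) → Injective _≡_ _≡_ (product ts)
product-injective []             = id
product-injective ((i , j) ∷ ts) = ∘-injective (swap-injective i j) (product-injective ts)

defect-product : ∀ (ts : List (Fin n × Fin n)) → All (λ (i , j) → i ≢ j) ts → defect n (product ts) ≤ length ts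
defect-product {n} []             []           = ≤-reflexive (defect-id n)
defect-product {n} ((i , j) ∷ ts) (i≢j ∷ ts≢) =
  ≤-trans (defect-swap n (product-injective ts) i≢j) (s≤s (defect-product ts ts≢))

liftPair : Fin n × Fin n → Fin (suc n) × Fin (suc n)
liftPair = Product.map suc suc

product-lift : ∀ (ts : List (Fin n × Fin n)) x → product (map liftPair ts) x ≡ lift 1 (product ts) x
product-lift []             zero    = refl
product-lift []             (suc x) = refl
product-lift ((i , j) ∷ ts) x       = trans (cong (swap (suc i) (suc j)) (product-lift ts x)) (swap-lift i j (product ts) x)

lift-cong : ∀ {f g : Fin n → Fin n} → f ≗ g → lift 1 f ≗ lift 1 g
lift-cong f≗g zero    = refl
lift-cong f≗g (suc x) = cong suc (f≗g x)

Ascending : List (Fin n × Fin n) → Set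
Ascending = All (λ (i , j) → toℕ i < toℕ j)

decompose : ∀ n {f : Fin n → Fin n} → Injective _≡_ _≡_ f →
            ∃[ ts ] length ts ≡ defect n f × Ascending ts × product ts ≗ f
decompose zero    f-inj = [] , refl , [] , λ ()
decompose (suc n) {f} f-inj with decompose n (remove0-injective f-inj)
... | ts , len , asc , ts≗ = extend (zero⊎suc (f zero))
  where
  lifted : ∀ x → swap zero (f zero) (product (map liftPair ts) x) ≡ f x
  lifted x = trans (cong (swap zero (f zero)) (trans (product-lift ts x) (lift-cong ts≗ x))) (swap∘lift-remove0 f-inj x)
  extend : f zero ≡ zero ⊎ ∃[ k ] f zero ≡ suc k →
           ∃[ us ] length us ≡ defect (suc n) f × Ascending us × product us ≗ f
  extend (inj₁ f0) =
    map liftPair ts ,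
    trans (length-map liftPair ts) (trans len (cong (λ y → nonZero y + defect n (remove0 f)) (sym f0))) ,
    All.map⁺ (All.map s≤s asc) ,
    λ x → trans (sym (swap-self zero _)) (trans (cong (λ y → swap zero y (product (map liftPair ts) x)) (sym f0)) (lifted x))
  extend (inj₂ (k , f0)) =
    (zero , suc k) ∷ map liftPair ts ,
    trans (cong suc (trans (length-map liftPair ts) len)) (cong (λ y → nonZero y + defect n (remove0 f)) (sym f0)) ,
    s≤s z≤n ∷ All.map⁺ (All.map s≤s asc) ,
    λ x → trans (cong (λ y → swap zero y (product (map liftPair ts) x)) (sym f0)) (lifted x)

-- Reflection length

∈-transpositions⁺ : ∀ {i j : Fin n} → toℕ i < toℕ j → (i , j) ∈ transpositions n
∈-transpositions⁺ {n} {i} {j} i<j =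
  ∈-concatMap⁺ _ (Any.map (λ where refl → ∈-map⁺ (i ,_) (∈-filter⁺ _ (∈-allFin j) (T⇒≡true (<⇒<ᵇ i<j)))) (∈-allFin i))

∈-transpositions⁻ : ∀ {i j : Fin n} → (i , j) ∈ transpositions n → toℕ i < toℕ j
∈-transpositions⁻ {n} t∈ with find (∈-concatMap⁻ _ {xs = allFin n} t∈)
... | i , _ , t∈i with ∈-map⁻ (i ,_) t∈i
...   | j , j∈ , refl = <ᵇ⇒< _ _ (≡true⇒T (proj₂ (∈-filter⁻ _ {xs = allFin n} j∈)))

∈-allVecs⁺ : ∀ {A : Set} {xs : List A} (ts : List A) → All (_∈ xs) ts → Vec.fromList ts ∈ allVecs xs (length ts)
∈-allVecs⁺ []       []          = here refl
∈-allVecs⁺ (t ∷ ts) (t∈ ∷ ts∈) =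
  ∈-concatMap⁺ _ (Any.map (λ where refl → ∈-map⁺ (t ∷ᵛ_) (∈-allVecs⁺ ts ts∈)) t∈)

∈-allVecs⁻ : ∀ {A : Set} {xs : List A} {n} (w : Vec A n) → w ∈ allVecs xs n → All (_∈ xs) (Vec.toList w)
∈-allVecs⁻ []        _  = []
∈-allVecs⁻ {xs = xs} {suc n} (x ∷ᵛ w) w∈ with find (∈-concatMap⁻ _ {xs = xs} w∈)
... | y , y∈ , w∈y with ∈-map⁻ (y ∷ᵛ_) w∈y
...   | w′ , w′∈ , refl = y∈ ∷ ∈-allVecs⁻ w′ w′∈

eqFun⇒≗ : ∀ (g : Fin n → Fin n) (π : Fun n) → T (eqFun g π) → ∀ x → g x ≡ lookup π x
eqFun⇒≗ {n} g π t x = toWitness (All.lookup (all⁺ _ (allFin n) t) (∈-allFin x))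

≗⇒eqFun : ∀ (g : Fin n → Fin n) (π : Fun n) → (∀ x → g x ≡ lookup π x) → T (eqFun g π)
≗⇒eqFun {n} g π g≗π = all⁻ (λ x → eqFin (g x) (lookup π x)) {allFin n} (All.tabulate (λ {x} _ → fromWitness (g≗π x)))

productOf-defect : ∀ (π : Fun n) → Injective _≡_ _≡_ (lookup π) → T (productOf (defect n (lookup π)) π)
productOf-defect {n} π π-inj with decompose n π-inj
... | ts , len , asc , ts≗ = subst (λ k → T (productOf k π)) len (any⁺ _ (lose ts∈ ts-ok))
  where
  ts∈ : Vec.fromList ts ∈ allVecs (transpositions n) (length ts)
  ts∈ = ∈-allVecs⁺ ts (All.map ∈-transpositions⁺ asc)
  ts-ok : T (eqFun (product (Vec.toList (Vec.fromList ts))) π)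
  ts-ok = ≗⇒eqFun _ π (λ x → trans (cong (λ us → product us x) (toList∘fromList ts)) (ts≗ x))

productOf⇒defect≤ : ∀ (π : Fun n) k → T (productOf k π) → defect n (lookup π) ≤ k
productOf⇒defect≤ {n} π k t with find (any⁻ _ (allVecs (transpositions n) k) t)
... | w , w∈ , w-ok = begin
  defect n (lookup π)                ≡⟨ defect-cong n (λ x → sym (eqFun⇒≗ _ π w-ok x)) ⟩
  defect n (product (Vec.toList w))  ≤⟨ defect-product (Vec.toList w) (All.map proper (∈-allVecs⁻ w w∈)) ⟩
  length (Vec.toList w)              ≡⟨ length-toList w ⟩
  k                                  ∎
  where
  open ≤-Reasoning
  proper : ∀ {t} → t ∈ transpositions n → proj₁ t ≢ proj₂ t
  proper t∈ i≡j = <-irrefl (cong toℕ i≡j) (∈-transpositions⁻ t∈)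

module _ {n} (π : Fun n) where

  firstHit : List ℕ → ℕ
  firstHit []       = n
  firstHit (k ∷ ks) = if productOf k π then k else firstHit ks

  -- reflLen searches with a function local to its definition, which cannot be named here.
  -- Abstracting search-spec before the remaining with-terms in reflLen≡firstHit lets
  -- unification instantiate s and w with that function and its with-auxiliary.
  search-spec : {s : List ℕ → ℕ} {w : ℕ → List ℕ → Bool → ℕ} →
                s [] ≡ n → (∀ k ks → s (k ∷ ks) ≡ w k ks (productOf k π)) →
                (∀ k ks → w k ks true ≡ k) → (∀ k ks → w k ks false ≡ s ks) →
                ∀ k ks b → w k ks b ≡ (if b then k else firstHit ks)
  search-spec {s} {w} s[] s∷ w-true w-false = spec
    where
    spec : ∀ k ks b → w k ks b ≡ (if b then k else firstHit ks)
    spec k ks        true  = w-true k ks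
    spec k []        false = trans (w-false k []) s[]
    spec k (k′ ∷ ks) false = trans (w-false k (k′ ∷ ks)) (trans (s∷ k′ ks) (spec k′ ks (productOf k′ π)))

  reflLen≡firstHit : reflLen π ≡ firstHit (upTo (suc n))
  reflLen≡firstHit with search-spec {w = _} | 0 | applyUpTo ℕ.suc n | productOf 0 π
  ... | spec | k | ks | b = spec refl (λ _ _ → refl) (λ _ _ → refl) (λ _ _ → refl) k ks b

  firstHit-applyUpTo : ∀ D → (∀ k → k < D → productOf k π ≡ false) → productOf D π ≡ true →
                       ∀ m c (f : ℕ → ℕ) → (∀ i → f i ≡ c + i) → c ≤ D → D < c + m → firstHit (applyUpTo f m) ≡ D
  firstHit-applyUpTo D miss hit zero    c f f≡ c≤D D<c =
    ⊥-elim (<-irrefl refl (<-≤-trans D<c (≤-trans (≤-reflexive (+-identityʳ c)) c≤D)))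
  firstHit-applyUpTo D miss hit (suc m) c f f≡ c≤D D<c+m rewrite f≡ 0 | +-identityʳ c with m≤n⇒m<n∨m≡n c≤D
  ... | inj₂ refl rewrite hit = refl
  ... | inj₁ c<D  rewrite miss c c<D =
    firstHit-applyUpTo D miss hit m (suc c) (f ∘ suc) (λ i → trans (f≡ (suc i)) (+-suc c i)) c<D
      (<-≤-trans D<c+m (≤-reflexive (+-suc c m)))

reflLen≡defect : ∀ (π : Fun n) → Injective _≡_ _≡_ (lookup π) → reflLen π ≡ defect n (lookup π)
reflLen≡defect {n} π π-inj = trans (reflLen≡firstHit π)
  (firstHit-applyUpTo π (defect n (lookup π)) miss (T⇒≡true (productOf-defect π π-inj))
    (suc n) 0 id (λ _ → refl) z≤n (s≤s (defect≤n n (lookup π))))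
  where
  miss : ∀ k → k < defect n (lookup π) → productOf k π ≡ false
  miss k k<d with productOf k π in hit
  ... | false = refl
  ... | true  = ⊥-elim (<-irrefl refl (<-≤-trans k<d (productOf⇒defect≤ π k (≡true⇒T hit))))

-- The recurrence for W

isPerm⇒injective : ∀ (f : Fun n) → T (isPerm f) → Injective _≡_ _≡_ (lookup f)
isPerm⇒injective {n} f t {x} {y} fx≡fy = toWitness (subst (λ b → T (not b ∨ eqFin x y)) (eqFin-≡ fx≡fy) txy)
  where
  txy : T (not (eqFin (lookup f x) (lookup f y)) ∨ eqFin x y)
  txy = All.lookup (all⁺ _ (allFin n) (All.lookup (all⁺ _ (allFin n) t) (∈-allFin x))) (∈-allFin y)

injective⇒isPerm : ∀ (f : Fun n) → Injective _≡_ _≡_ (lookup f) → T (isPerm f)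
injective⇒isPerm {n} f f-inj =
  all⁻ _ {allFin n} (All.tabulate (λ {x} _ → all⁻ _ {allFin n} (All.tabulate (λ {y} _ → pair x y))))
  where
  pair : ∀ x y → T (not (eqFin (lookup f x) (lookup f y)) ∨ eqFin x y)
  pair x y with ≡⊎≢ (lookup f x) (lookup f y)
  ... | inj₁ fx≡fy = Equivalence.from T-∨ (inj₂ (fromWitness {a? = x ≟ y} (f-inj fx≡fy)))
  ... | inj₂ fx≢fy = Equivalence.from T-∨ (inj₁ (subst (T ∘ not) (sym (eqFin-≢ fx≢fy)) _))

-- insert0 j π inserts 0 into the cycle structure of π (shifted up by one) just before j, or as a
-- fixed point when j = 0; remove0 undoes it (remove0-insert0).
splice : Fin (suc n) → Fin n → Fin (suc n)
splice zero    y = suc y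
splice (suc j) y = if eqFin y j then zero else suc y

insert0 : Fin (suc n) → Fun n → Fun (suc n)
insert0 j π = j ∷ᵛ Vec.map (splice j) π

lookup-insert0 : ∀ (j : Fin (suc n)) π x → lookup (insert0 j π) (suc x) ≡ splice j (lookup π x)
lookup-insert0 j π x = lookup-map x (splice j) π

splice-≢ : ∀ (j : Fin (suc n)) y → splice j y ≢ j
splice-≢ zero    y ()
splice-≢ (suc j) y with ≡⊎≢ y j
... | inj₁ y≡j rewrite eqFin-≡ y≡j = λ ()
... | inj₂ y≢j rewrite eqFin-≢ y≢j = y≢j ∘ suc-injective

splice-injective : ∀ (j : Fin (suc n)) → Injective _≡_ _≡_ (splice j)
splice-injective zero    = suc-injective
splice-injective (suc j) {x} {y} eq with ≡⊎≢ x j | ≡⊎≢ y j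
... | inj₁ x≡j | inj₁ y≡j = trans x≡j (sym y≡j)
... | inj₁ x≡j | inj₂ y≢j rewrite eqFin-≡ x≡j | eqFin-≢ y≢j with () ← eq
... | inj₂ x≢j | inj₁ y≡j rewrite eqFin-≢ x≢j | eqFin-≡ y≡j with () ← eq
... | inj₂ x≢j | inj₂ y≢j rewrite eqFin-≢ x≢j | eqFin-≢ y≢j = suc-injective eq

cut0-splice : ∀ (j : Fin (suc n)) y x → cut0 (splice j y) j x ≡ y
cut0-splice zero    y x = refl
cut0-splice (suc j) y x with ≡⊎≢ y j
... | inj₁ y≡j rewrite eqFin-≡ y≡j = sym y≡j
... | inj₂ y≢j rewrite eqFin-≢ y≢j = refl

remove0-insert0 : ∀ (j : Fin (suc n)) π x → remove0 (lookup (insert0 j π)) x ≡ lookup π x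
remove0-insert0 j π x = trans (cong (λ z → cut0 z j x) (lookup-insert0 j π x)) (cut0-splice j (lookup π x) x)

insert0-injective : ∀ (j : Fin (suc n)) π → Injective _≡_ _≡_ (lookup π) → Injective _≡_ _≡_ (lookup (insert0 j π))
insert0-injective j π π-inj {zero}  {zero}  _  = refl
insert0-injective j π π-inj {zero}  {suc y} eq = ⊥-elim (splice-≢ j (lookup π y) (sym (trans eq (lookup-insert0 j π y))))
insert0-injective j π π-inj {suc x} {zero}  eq = ⊥-elim (splice-≢ j (lookup π x) (trans (sym (lookup-insert0 j π x)) eq))
insert0-injective j π π-inj {suc x} {suc y} eq =
  cong suc (π-inj (splice-injective j (trans (sym (lookup-insert0 j π x)) (trans eq (lookup-insert0 j π y)))))

insert0-injective⁻ : ∀ (j : Fin (suc n)) π → Injective _≡_ _≡_ (lookup (insert0 j π)) → Injective _≡_ _≡_ (lookup π)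
insert0-injective⁻ j π σ-inj {x} {y} eq =
  suc-injective (σ-inj (trans (lookup-insert0 j π x) (trans (cong (splice j) eq) (sym (lookup-insert0 j π y)))))

isPerm-insert0 : ∀ (j : Fin (suc n)) π → isPerm (insert0 j π) ≡ isPerm π
isPerm-insert0 j π = T-ext
  (λ t → injective⇒isPerm π (insert0-injective⁻ j π (isPerm⇒injective (insert0 j π) t)))
  (λ t → injective⇒isPerm (insert0 j π) (insert0-injective j π (isPerm⇒injective π t)))

isPerm-repeated : ∀ (j : Fin (suc n)) (w : Vec (Fin (suc n)) n) i → lookup w i ≡ j → isPerm (j ∷ᵛ w) ≡ false
isPerm-repeated j w i wi≡j = T-ext (λ t → case (isPerm⇒injective (j ∷ᵛ w) t wi≡j)) (λ ())
  where
  case : suc i ≢ zero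
  case ()

∑-splice : ∀ (j : Fin (suc n)) (H : Fin (suc n) → ℕ) → ∑ H ≡ H j + ∑[ y < n ] H (splice j y)
∑-splice zero    H = refl
∑-splice (suc j) H = begin
  H zero + ∑ (H ∘ suc)                  ≡⟨ cong (λ z → H z + ∑ (H ∘ suc)) (sym spliced-j) ⟩
  H (splice (suc j) j) + ∑ (H ∘ suc)    ≡⟨ ∑-exchange (H ∘ suc) (H ∘ splice (suc j)) j agree ⟩
  H (suc j) + ∑ (H ∘ splice (suc j))    ∎
  where
  open ≡-Reasoning
  spliced-j : splice (suc j) j ≡ zero
  spliced-j rewrite eqFin-≡ (refl {x = j}) = refl
  agree : ∀ y → y ≢ j → H (suc y) ≡ H (splice (suc j) y)
  agree y y≢j rewrite eqFin-≢ y≢j = refl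

sumOver-allFin-splice : ∀ (j : Fin (suc n)) (H : Fin (suc n) → ℕ) →
                        sumOver (allFin (suc n)) H ≡ sumOver (j ∷ map (splice j) (allFin n)) H
sumOver-allFin-splice {n} j H = begin
  sumOver (allFin (suc n)) H                  ≡⟨ sumOver-allFin (suc n) H ⟩
  ∑ H                                         ≡⟨ ∑-splice j H ⟩
  H j + ∑[ y < n ] H (splice j y)             ≡⟨ cong (H j +_) (sumOver-allFin n (H ∘ splice j)) ⟨
  H j + sumOver (allFin n) (H ∘ splice j)     ≡⟨ cong (H j +_) (sumOver-map (splice j) (allFin n)) ⟨
  sumOver (j ∷ map (splice j) (allFin n)) H   ∎
  where open ≡-Reasoning

∑perm : ∀ n → (Fun n → ℕ) → ℕ
∑perm n F = ∑[ π ∈ allVecs (allFin n) n ] (𝟙 (isPerm π) * F π)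

∑perm-suc : ∀ n (F : Fun (suc n) → ℕ) → ∑perm (suc n) F ≡ ∑[ j < suc n ] ∑perm n (F ∘ insert0 j)
∑perm-suc n F = begin
  ∑perm (suc n) F
    ≡⟨ sumOver-allVecs-suc (allFin (suc n)) n _ ⟩
  ∑[ j ∈ allFin (suc n) ] sumOver (allVecs (allFin (suc n)) n) (G j)
    ≡⟨ sumOver-allFin (suc n) _ ⟩
  ∑[ j < suc n ] sumOver (allVecs (allFin (suc n)) n) (G j)
    ≡⟨ sum-cong-≗ headFixed ⟩
  ∑[ j < suc n ] ∑perm n (F ∘ insert0 j)
    ∎
  where
  open ≡-Reasoning
  G : Fin (suc n) → Vec (Fin (suc n)) n → ℕ
  G j w = 𝟙 (isPerm (j ∷ᵛ w)) * F (j ∷ᵛ w)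
  headFixed : ∀ j → sumOver (allVecs (allFin (suc n)) n) (G j) ≡ ∑perm n (F ∘ insert0 j)
  headFixed j = begin
    sumOver (allVecs (allFin (suc n)) n) (G j)
      ≡⟨ sumOver-allVecs-cong (allFin (suc n)) _ (sumOver-allFin-splice j) n (G j) ⟩
    sumOver (allVecs (j ∷ map (splice j) (allFin n)) n) (G j)
      ≡⟨ sumOver-allVecs-drop j _ n (G j) (λ w i wi≡j → cong (λ b → 𝟙 b * F (j ∷ᵛ w)) (isPerm-repeated j w i wi≡j)) ⟩
    sumOver (allVecs (map (splice j) (allFin n)) n) (G j)
      ≡⟨ sumOver-allVecs-map (splice j) (allFin n) n (G j) ⟩
    ∑[ π ∈ allVecs (allFin n) n ] G j (Vec.map (splice j) π)
      ≡⟨ sumOver-cong (allVecs (allFin n) n) (λ π → cong (λ b → 𝟙 b * F (insert0 j π)) (isPerm-insert0 j π)) ⟩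
    ∑perm n (F ∘ insert0 j)
      ∎

∑perm-cong : ∀ n {F G : Fun n → ℕ} → (∀ π → T (isPerm π) → F π ≡ G π) → ∑perm n F ≡ ∑perm n G
∑perm-cong n F≡G = sumOver-cong (allVecs (allFin n) n) on-perms
  where
  on-perms : ∀ π → 𝟙 (isPerm π) * _ ≡ 𝟙 (isPerm π) * _
  on-perms π with isPerm π in perm
  ... | true  = cong (1 *_) (F≡G π (subst T (sym perm) _))
  ... | false = refl

∑perm-+ : ∀ n (F G : Fun n → ℕ) → ∑perm n (λ π → F π + G π) ≡ ∑perm n F + ∑perm n G
∑perm-+ n F G = trans (sumOver-cong (allVecs (allFin n) n) (λ π → *-distribˡ-+ (𝟙 (isPerm π)) (F π) (G π)))
                      (sumOver-+ (allVecs (allFin n) n))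

∑perm-const : ∀ n c → ∑perm n (λ _ → c) ≡ n ! * c
∑perm-const zero    c = +-identityʳ (1 * c)
∑perm-const (suc n) c = begin
  ∑perm (suc n) (λ _ → c)          ≡⟨ ∑perm-suc n (λ _ → c) ⟩
  ∑[ j < suc n ] ∑perm n (λ _ → c)  ≡⟨ sum-cong-≗ {suc n} (λ _ → ∑perm-const n c) ⟩
  ∑[ j < suc n ] (n ! * c)          ≡⟨ ∑-const (suc n) (n ! * c) ⟩
  suc n * (n ! * c)                 ≡⟨ *-assoc (suc n) (n !) c ⟨
  suc n ! * c                       ∎
  where open ≡-Reasoning

reflLen-insert0 : ∀ (j : Fin (suc n)) π → T (isPerm π) → reflLen (insert0 j π) ≡ nonZero j + reflLen π
reflLen-insert0 {n} j π perm = begin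
  reflLen (insert0 j π)                                  ≡⟨ reflLen≡defect (insert0 j π) (insert0-injective j π π-inj) ⟩
  nonZero j + defect n (remove0 (lookup (insert0 j π)))  ≡⟨ cong (nonZero j +_) (defect-cong n (remove0-insert0 j π)) ⟩
  nonZero j + defect n (lookup π)                        ≡⟨ cong (nonZero j +_) (reflLen≡defect π π-inj) ⟨
  nonZero j + reflLen π                                  ∎
  where
  open ≡-Reasoning
  π-inj = isPerm⇒injective π perm

-- n! (n − Hₙ), the common value of both sides, through its recurrence.
weightRec : ℕ → ℕ
weightRec zero    = 0
weightRec (suc n) = suc n * weightRec n + n * n !

∑nonZero : ∀ n → ∑[ j < suc n ] nonZero j ≡ n
∑nonZero n = trans (∑-const n 1) (*-identityʳ n)

∑perm-reflLen : ∀ n → ∑perm n reflLen ≡ weightRec n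
∑perm-reflLen zero    = refl
∑perm-reflLen (suc n) = begin
  ∑perm (suc n) reflLen
    ≡⟨ ∑perm-suc n reflLen ⟩
  ∑[ j < suc n ] ∑perm n (reflLen ∘ insert0 j)
    ≡⟨ sum-cong-≗ (λ j → ∑perm-cong n (reflLen-insert0 j)) ⟩
  ∑[ j < suc n ] ∑perm n (λ π → nonZero j + reflLen π)
    ≡⟨ sum-cong-≗ {suc n} (λ j → trans (∑perm-+ n (λ _ → nonZero j) reflLen)
                                      (cong₂ _+_ (∑perm-const n (nonZero j)) (∑perm-reflLen n))) ⟩
  ∑[ j < suc n ] (n ! * nonZero j + weightRec n)
    ≡⟨ ∑-distrib-+ {suc n} (λ j → n ! * nonZero j) (λ _ → weightRec n) ⟩
  ∑[ j < suc n ] (n ! * nonZero j) + ∑[ j < suc n ] weightRec n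
    ≡⟨ cong₂ _+_ (sym (*-distribˡ-sum (n !) (nonZero {n}))) (∑-const (suc n) (weightRec n)) ⟩
  n ! * ∑[ j < suc n ] nonZero j + suc n * weightRec n
    ≡⟨ cong (λ s → n ! * s + suc n * weightRec n) (∑nonZero n) ⟩
  n ! * n + suc n * weightRec n
    ≡⟨ trans (+-comm (n ! * n) _) (cong (suc n * weightRec n +_) (*-comm (n !) n)) ⟩
  weightRec (suc n)
    ∎
  where open ≡-Reasoning

W≡weightRec : ∀ n → W n ≡ weightRec n
W≡weightRec n = trans (sum-map-filter isPerm reflLen (allVecs (allFin n) n)) (∑perm-reflLen n)

-- Forests with a single non-record

ancestor : ParentMap n → ℕ → Fin n → Maybe (Fin n)
ancestor par k v = iterate (step par) k (just v)

iterate-suc : ∀ {A : Set} (f : A → A) k a → iterate f (suc k) a ≡ iterate f k (f a)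
iterate-suc f zero    a = refl
iterate-suc f (suc k) a = cong f (iterate-suc f k a)

iterate-nothing : ∀ (par : ParentMap n) k → iterate (step par) k nothing ≡ nothing
iterate-nothing par zero    = refl
iterate-nothing par (suc k) = cong (step par) (iterate-nothing par k)

ancestor-suc : ∀ (par : ParentMap n) k v → ancestor par (suc k) v ≡ iterate (step par) k (lookup par v)
ancestor-suc par k v = iterate-suc (step par) k (just v)

Below : Fin n → Maybe (Fin n) → Set
Below v = Maybe.All (λ w → toℕ w < toℕ v)

isForest⇒ : ∀ (par : ParentMap n) → T (isForest par) → ∀ v → ancestor par n v ≡ nothing
isForest⇒ {n} par t v with iterate (step par) n (just v) | All.lookup (all⁺ _ (allFin n) t) (∈-allFin v)
... | nothing | _ = refl

-- The tests inside isForest and isRecord are functions local to Defs, which only compute after a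
-- `with` on the ancestor; so the converse directions refute a counterexample instead.
isForest⇐ : ∀ (par : ParentMap n) → (∀ v → ancestor par n v ≡ nothing) → T (isForest par)
isForest⇐ {n} par roots with T? (isForest par)
... | yes t = t
... | no ¬t with find (¬All⇒Any¬ (T? ∘ _) (allFin n) (¬t ∘ all⁻ _))
...   | v , _ , ¬tv with iterate (step par) n (just v) | roots v | ¬tv
...     | .nothing | refl | ¬t′ = ⊥-elim (¬t′ _)

isRecord⇒ : ∀ (par : ParentMap n) v → T (isRecord par v) → ∀ k → k < n → Below v (ancestor par (suc k) v)
isRecord⇒ {n} par v t k k<n with iterate (step par) (suc k) (just v) | All.lookup (all⁺ _ (upTo n) t) (∈-upTo⁺ k<n)
... | nothing | _  = nothing
... | just w  | tw = just (<ᵇ⇒< _ _ tw)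

isRecord⇐ : ∀ (par : ParentMap n) v → (∀ k → k < n → Below v (ancestor par (suc k) v)) → T (isRecord par v)
isRecord⇐ {n} par v below with T? (isRecord par v)
... | yes t = t
... | no ¬t with find (¬All⇒Any¬ (T? ∘ _) (upTo n) (¬t ∘ all⁻ _))
...   | k , k∈ , ¬tk with iterate (step par) (suc k) (just v) | below k (∈-upTo⁻ k∈) | ¬tk
...     | nothing | _      | ¬t′ = ⊥-elim (¬t′ _)
...     | just w  | just b | ¬t′ = ⊥-elim (¬t′ (<⇒<ᵇ b))

Admissible : ∀ {N} (u p v : Fin N) → Maybe (Fin N) → Set
Admissible u p v x = (v ≡ u → x ≡ just p × toℕ u < toℕ p)
                   × (v ≢ u → Maybe.All (λ w → toℕ w < toℕ v × (w ≡ u → toℕ p < toℕ v)) x)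

-- The parent maps of the forests whose only non-record is u, with parent p
-- (soleNonRecord⇒records and records⇒soleNonRecord).
SoleNonRecord : ∀ {N} → ParentMap N → Fin N → Fin N → Set
SoleNonRecord par u p = ∀ v → Admissible u p v (lookup par v)

-- slot u p v is the number of admissible parents of v ≢ u, the root included (count-admissible).
-- Under the relabelling rank, which moves u to just above p, these are the root and the vertices
-- of smaller rank, so every parent pointer of a SoleNonRecord map decreases the rank.
slot : ℕ → ℕ → ℕ → ℕ
slot u p x = if (u <ᵇ x) ∧ not (p <ᵇ x) then x else suc x

rank : ℕ → ℕ → ℕ → ℕ
rank u p x = if x ≡ᵇ u then suc p else slot u p x

slot-inside : ∀ {u p x} → u < x → x ≤ p → slot u p x ≡ x
slot-inside u<x x≤p rewrite <ᵇ-true u<x | <ᵇ-false x≤p = refl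

slot-≤ : ∀ {u p x} → x ≤ u → slot u p x ≡ suc x
slot-≤ x≤u rewrite <ᵇ-false x≤u = refl

slot-> : ∀ {u p x} → p < x → slot u p x ≡ suc x
slot-> {u} {x = x} p<x rewrite <ᵇ-true p<x | ∧-zeroʳ (u <ᵇ x) = refl

rank-≡ : ∀ u {p} → rank u p u ≡ suc p
rank-≡ u rewrite ≡ᵇ-true (refl {x = u}) = refl

rank-≢ : ∀ {u p x} → x ≢ u → rank u p x ≡ slot u p x
rank-≢ x≢u rewrite ≡ᵇ-false x≢u = refl

0<slot : ∀ u p x → 0 < slot u p x
0<slot u p x with u <ᵇ x in u<ᵇx | p <ᵇ x
... | true  | true  = z<s
... | true  | false = ≤-<-trans z≤n (<ᵇ⇒< u x (subst T (sym u<ᵇx) _))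
... | false | _     = z<s

slot≤1+ : ∀ u p x → slot u p x ≤ suc x
slot≤1+ u p x with (u <ᵇ x) ∧ not (p <ᵇ x)
... | true  = n≤1+n x
... | false = ≤-refl

slot-< : ∀ {u p a b} → b ≢ u → b < a → slot u p b < slot u p a
slot-< {u} {p} {a} {b} b≢u b<a with u <? a | p <? a
... | no  a≮u | _       = subst (slot u p b <_) (sym (slot-≤ (≮⇒≥ a≮u))) (s≤s (≤-trans (slot≤1+ u p b) b<a))
... | yes u<a | yes p<a = subst (slot u p b <_) (sym (slot-> p<a)) (s≤s (≤-trans (slot≤1+ u p b) b<a))
... | yes u<a | no  p≮a with u <? b
...   | yes u<b =
  subst₂ _<_ (sym (slot-inside u<b (≤-trans (<⇒≤ b<a) (≮⇒≥ p≮a)))) (sym (slot-inside u<a (≮⇒≥ p≮a))) b<a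
...   | no  b≮u =
  subst₂ _<_ (sym (slot-≤ (≮⇒≥ b≮u))) (sym (slot-inside u<a (≮⇒≥ p≮a))) (≤-<-trans (≤∧≢⇒< (≮⇒≥ b≮u) b≢u) u<a)

module SoleNonRecord {N} {par : ParentMap N} {u p : Fin N} (sole : SoleNonRecord par u p) where

  parent-u : lookup par u ≡ just p
  parent-u = proj₁ (proj₁ (sole u) refl)

  u<p : toℕ u < toℕ p
  u<p = proj₂ (proj₁ (sole u) refl)

  parent-v : ∀ v → v ≢ u → Maybe.All (λ w → toℕ w < toℕ v × (w ≡ u → toℕ p < toℕ v)) (lookup par v)
  parent-v v = proj₂ (sole v)

  rank′ : Fin N → ℕ
  rank′ x = rank (toℕ u) (toℕ p) (toℕ x)

  rank-step : ∀ a {b} → lookup par a ≡ just b → rank′ b < rank′ a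
  rank-step a {b} pa≡b with ≡⊎≢ a u
  ... | inj₁ refl with just-injective (trans (sym pa≡b) parent-u)
  ...   | refl = begin-strict
    rank′ p                      ≡⟨ rank-≢ (>⇒≢ u<p) ⟩
    slot (toℕ u) (toℕ p) (toℕ p) ≡⟨ slot-inside u<p ≤-refl ⟩
    toℕ p                        <⟨ n<1+n (toℕ p) ⟩
    suc (toℕ p)                  ≡⟨ rank-≡ (toℕ u) ⟨
    rank′ u                      ∎
    where open ≤-Reasoning
  rank-step a {b} pa≡b | inj₂ a≢u with lookup par a | parent-v a a≢u | pa≡b
  ... | just .b | just (b<a , b≡u⇒p<a) | refl with ≡⊎≢ b u
  ...   | inj₁ refl = begin-strict
    rank′ b                ≡⟨ rank-≡ (toℕ u) ⟩
    suc (toℕ p)            <⟨ s≤s (b≡u⇒p<a refl) ⟩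
    suc (toℕ a)            ≡⟨ slot-> (b≡u⇒p<a refl) ⟨
    slot (toℕ u) (toℕ p) (toℕ a) ≡⟨ rank-≢ (a≢u ∘ toℕ-injective) ⟨
    rank′ a                ∎
    where open ≤-Reasoning
  ...   | inj₂ b≢u = begin-strict
    rank′ b                ≡⟨ rank-≢ (b≢u ∘ toℕ-injective) ⟩
    slot (toℕ u) (toℕ p) (toℕ b) <⟨ slot-< (b≢u ∘ toℕ-injective) b<a ⟩
    slot (toℕ u) (toℕ p) (toℕ a) ≡⟨ rank-≢ (a≢u ∘ toℕ-injective) ⟨
    rank′ a                ∎
    where open ≤-Reasoning

  0<rank′ : ∀ x → 0 < rank′ x
  0<rank′ x with ≡⊎≢ x u
  ... | inj₁ refl = subst (0 <_) (sym (rank-≡ (toℕ u))) z<s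
  ... | inj₂ x≢u  = subst (0 <_) (sym (rank-≢ (x≢u ∘ toℕ-injective))) (0<slot (toℕ u) (toℕ p) (toℕ x))

  rank′≤N : ∀ x → rank′ x ≤ N
  rank′≤N x with ≡⊎≢ x u
  ... | inj₁ refl = subst (_≤ N) (sym (rank-≡ (toℕ u))) (toℕ<n p)
  ... | inj₂ x≢u  = subst (_≤ N) (sym (rank-≢ (x≢u ∘ toℕ-injective))) (≤-trans (slot≤1+ _ _ (toℕ x)) (toℕ<n x))

  ancestor-rank : ∀ v k → ancestor par k v ≡ nothing ⊎ ∃[ w ] ancestor par k v ≡ just w × rank′ w + k ≤ rank′ v
  ancestor-rank v zero    = inj₂ (v , refl , ≤-reflexive (+-identityʳ (rank′ v)))
  ancestor-rank v (suc k) with ancestor-rank v k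
  ... | inj₁ none = inj₁ (cong (step par) none)
  ... | inj₂ (w , anc≡w , w+k≤v) with lookup par w in pw
  ...   | nothing = inj₁ (trans (cong (step par) anc≡w) pw)
  ...   | just w′ = inj₂ (w′ , trans (cong (step par) anc≡w) pw , (begin
    rank′ w′ + suc k   ≡⟨ +-suc (rank′ w′) k ⟩
    suc (rank′ w′ + k) ≤⟨ +-monoˡ-≤ k (rank-step w pw) ⟩
    rank′ w + k        ≤⟨ w+k≤v ⟩
    rank′ v            ∎))
    where open ≤-Reasoning

  forest : T (isForest par)
  forest = isForest⇐ par root
    where
    root : ∀ v → ancestor par N v ≡ nothing
    root v with ancestor-rank v N
    ... | inj₁ none            = none
    ... | inj₂ (w , _ , w+N≤v) = ⊥-elim (<-irrefl refl (≤-trans (+-monoˡ-≤ N (0<rank′ w)) (≤-trans w+N≤v (rank′≤N v))))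

  ancestors-below : ∀ v → v ≢ u → ∀ k →
                    Maybe.All (λ a → toℕ a < toℕ v × (a ≡ u → toℕ p < toℕ v)) (ancestor par (suc k) v)
  ancestors-below v v≢u zero    = parent-v v v≢u
  ancestors-below v v≢u (suc k) with iterate (step par) (suc k) (just v) | ancestors-below v v≢u k
  ... | nothing | nothing = nothing
  ... | just a  | just (a<v , a≡u⇒p<v) with ≡⊎≢ a u
  ...   | inj₁ refl rewrite parent-u = just (a≡u⇒p<v refl , λ _ → a≡u⇒p<v refl)
  ...   | inj₂ a≢u with lookup par a | parent-v a a≢u
  ...     | nothing | nothing = nothing
  ...     | just w  | just (w<a , w≡u⇒p<a) = just (<-trans w<a a<v , λ w≡u → <-trans (w≡u⇒p<a w≡u) a<v)

  record-v : ∀ v → v ≢ u → T (isRecord par v)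
  record-v v v≢u = isRecord⇐ par v (λ k _ → Maybe.map proj₁ (ancestors-below v v≢u k))

  nonRecord-u : ¬ T (isRecord par u)
  nonRecord-u t with lookup par u | parent-u | isRecord⇒ par u t 0 (≤-<-trans z≤n (toℕ<n u))
  ... | .(just p) | refl | just p<u = <-asym p<u u<p

  unique : ∀ {u′ p′} → SoleNonRecord par u′ p′ → u′ ≡ u × p′ ≡ p
  unique {u′} {p′} sole′ with proj₁ (sole′ u′) refl | ≡⊎≢ u′ u
  ... | parent-u′ , _     | inj₁ refl = refl , just-injective (trans (sym parent-u′) parent-u)
  ... | parent-u′ , u′<p′ | inj₂ u′≢u with lookup par u′ | parent-v u′ u′≢u | parent-u′
  ...   | .(just p′) | just (p′<u′ , _) | refl = ⊥-elim (<-asym p′<u′ u′<p′)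

records≡∑ : ∀ (par : ParentMap n) → records par ≡ ∑[ v < n ] 𝟙 (isRecord par v)
records≡∑ {n} par = trans (length-filter (isRecord par) (allFin n)) (sumOver-allFin n _)

soleNonRecord⇒records : ∀ {m} {par : ParentMap (suc m)} {u p} → SoleNonRecord par u p →
                        T (isForest par) × records par ≡ m
soleNonRecord⇒records {par = par} {u} sole =
  forest , trans (records≡∑ par) (exactlyOneFalse⁻ (isRecord par) u nonRecord-u record-v)
  where open SoleNonRecord {par = par} sole

two-elements : ∀ {a b : Fin n} → a ≢ b → 1 < n
two-elements {suc zero}    {zero} {zero} a≢b = ⊥-elim (a≢b refl)
two-elements {suc (suc _)} _                 = s≤s (s≤s z≤n)

module FromRecords {m} {par : ParentMap (suc m)} (forest : T (isForest par)) {u : Fin (suc m)}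
                   (nonRecord-u : ¬ T (isRecord par u)) (record-v : ∀ v → v ≢ u → T (isRecord par v)) where

  parent-of-u : ∃[ p ] lookup par u ≡ just p × toℕ u < toℕ p
  parent-of-u = from (lookup par u) refl
    where
    from : ∀ x → lookup par u ≡ x → ∃[ p ] lookup par u ≡ just p × toℕ u < toℕ p
    from nothing pu = ⊥-elim (nonRecord-u (isRecord⇐ par u (λ k _ → subst (Below u) (sym (root k)) nothing)))
      where
      root : ∀ k → ancestor par (suc k) u ≡ nothing
      root k = trans (ancestor-suc par k u) (trans (cong (iterate (step par) k) pu) (iterate-nothing par k))
    from (just w) pu with <-cmp (toℕ w) (toℕ u)
    ... | tri> _ _ u<w = w , pu , u<w
    ... | tri≈ _ w≡u _ = ⊥-elim (just≢nothing (trans (sym (cycle (suc m))) (isForest⇒ par forest u)))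
      where
      just≢nothing : just u ≢ nothing
      just≢nothing ()
      cycle : ∀ k → ancestor par k u ≡ just u
      cycle zero    = refl
      cycle (suc k) = trans (cong (step par) (cycle k)) (trans pu (cong just (toℕ-injective w≡u)))
    ... | tri< w<u _ _ = ⊥-elim (nonRecord-u (isRecord⇐ par u below))
      where
      below : ∀ k → k < suc m → Below u (ancestor par (suc k) u)
      below zero    _   = subst (Below u) (sym pu) (just w<u)
      below (suc k) k<N = subst (Below u) (sym (trans (ancestor-suc par (suc k) u) (cong (iterate (step par) (suc k)) pu)))
        (Maybe.map (λ a<w → <-trans a<w w<u) (isRecord⇒ par w (record-v w (<⇒≢ w<u ∘ cong toℕ)) k (<-trans (n<1+n k) k<N)))

  p : Fin (suc m)
  p = proj₁ parent-of-u

  parent-u : lookup par u ≡ just p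
  parent-u = proj₁ (proj₂ parent-of-u)

  parent-v : ∀ v → v ≢ u → Maybe.All (λ w → toℕ w < toℕ v × (w ≡ u → toℕ p < toℕ v)) (lookup par v)
  parent-v v v≢u = from (lookup par v) refl (isRecord⇒ par v (record-v v v≢u) 0 (≤-<-trans z≤n (toℕ<n v)))
    where
    from : ∀ x → lookup par v ≡ x → Below v x → Maybe.All (λ w → toℕ w < toℕ v × (w ≡ u → toℕ p < toℕ v)) x
    from nothing  _  _          = nothing
    from (just w) pv (just w<v) = just (w<v , p<v)
      where
      p<v : w ≡ u → toℕ p < toℕ v
      p<v refl = lt (subst (Below v) (trans (cong (step par) pv) parent-u)
                            (isRecord⇒ par v (record-v v v≢u) 1 (two-elements v≢u)))
        where
        lt : Below v (just p) → toℕ p < toℕ v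
        lt (just p<v) = p<v

  sole : SoleNonRecord par u p
  sole v with ≡⊎≢ v u
  ... | inj₁ refl = (λ _ → parent-u , proj₂ (proj₂ parent-of-u)) , (λ v≢v → ⊥-elim (v≢v refl))
  ... | inj₂ v≢u  = (λ v≡u → ⊥-elim (v≢u v≡u)) , (λ _ → parent-v v v≢u)

records⇒soleNonRecord : ∀ {m} (par : ParentMap (suc m)) → T (isForest par) → records par ≡ m →
                        ∃[ u ] ∃[ p ] SoleNonRecord par u p
records⇒soleNonRecord par forest records≡m with exactlyOneFalse (isRecord par) (trans (sym (records≡∑ par)) records≡m)
... | u , nonRecord-u , record-v = u , _ , FromRecords.sole forest nonRecord-u record-v

-- Counting forests with a single non-record

admissible? : ∀ {N} (u p v : Fin N) x → Dec (Admissible u p v x)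
admissible? u p v x =
  (v ≟ u →-dec (≡-dec _≟_ x (just p) ×-dec toℕ u <? toℕ p)) ×-dec
  (¬? (v ≟ u) →-dec Maybe.dec (λ w → toℕ w <? toℕ v ×-dec (w ≟ u →-dec toℕ p <? toℕ v)) x)

module _ {m} (par : ParentMap (suc m)) where
  private
    N = suc m

  soleIndicator : Fin N → Fin N → ℕ
  soleIndicator u p = ∏[ v < N ] 𝟙 (does (admissible? u p v (lookup par v)))

  soleIndicator≡0 : ∀ u p → ¬ SoleNonRecord par u p → soleIndicator u p ≡ 0
  soleIndicator≡0 u p = ∏-𝟙-¬all (λ v → admissible? u p v (lookup par v))

  𝟙-records≡∑soleIndicator : 𝟙 (isForest par ∧ (records par ≡ᵇ m)) ≡ ∑[ u < N ] ∑[ p < N ] soleIndicator u p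
  𝟙-records≡∑soleIndicator with T? (isForest par ∧ (records par ≡ᵇ m))
  ... | yes t with records⇒soleNonRecord par (proj₁ (Equivalence.to T-∧ t)) (≡ᵇ⇒≡ _ _ (proj₂ (Equivalence.to T-∧ t)))
  ...   | u₀ , p₀ , sole = begin
    𝟙 (isForest par ∧ (records par ≡ᵇ m))  ≡⟨ cong 𝟙 (T⇒≡true t) ⟩
    1                                      ≡⟨ ∏-𝟙-all (λ v → admissible? u₀ p₀ v (lookup par v)) sole ⟨
    soleIndicator u₀ p₀                    ≡⟨ ∑-single (soleIndicator u₀) p₀ other-p ⟨
    ∑[ p < N ] soleIndicator u₀ p          ≡⟨ ∑-single (λ u → ∑[ p < N ] soleIndicator u p) u₀ other-u ⟨
    ∑[ u < N ] ∑[ p < N ] soleIndicator u p ∎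
    where
    open ≡-Reasoning
    open SoleNonRecord {par = par} sole using (unique)
    other-p : ∀ p → p ≢ p₀ → soleIndicator u₀ p ≡ 0
    other-p p p≢p₀ = soleIndicator≡0 u₀ p (p≢p₀ ∘ proj₂ ∘ unique)
    other-u : ∀ u → u ≢ u₀ → ∑[ p < N ] soleIndicator u p ≡ 0
    other-u u u≢u₀ = ∑-zero (soleIndicator u) (λ p → soleIndicator≡0 u p (u≢u₀ ∘ proj₁ ∘ unique))
  𝟙-records≡∑soleIndicator | no ¬t =
    trans (cong 𝟙 (¬T⇒≡false ¬t)) (sym (∑-zero _ (λ u → ∑-zero _ (λ p → soleIndicator≡0 u p not-sole))))
    where
    not-sole : ∀ {u p} → ¬ SoleNonRecord par u p
    not-sole sole with soleNonRecord⇒records sole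
    ... | forest , records≡m = ¬t (Equivalence.from T-∧ (forest , ≡⇒≡ᵇ _ _ records≡m))

parentChoices : ℕ → ℕ → ℕ → ℕ
parentChoices u p v = if v ≡ᵇ u then 𝟙 (u <ᵇ p) else slot u p v

parentChoices-≡ : ∀ u {p} → parentChoices u p u ≡ 𝟙 (u <ᵇ p)
parentChoices-≡ u rewrite ≡ᵇ-true (refl {x = u}) = refl

parentChoices-≢ : ∀ {u p v} → v ≢ u → parentChoices u p v ≡ slot u p v
parentChoices-≢ v≢u rewrite ≡ᵇ-false v≢u = refl

module _ {N} (u p v : Fin N) where
  private
    h : Fin N → ℕ
    h w = 𝟙 (does (admissible? u p v (just w)))

    options : ∑[ x ∈ parentOptions N ] 𝟙 (does (admissible? u p v x)) ≡ 𝟙 (does (admissible? u p v nothing)) + ∑[ w < N ] h w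
    options = cong (𝟙 (does (admissible? u p v nothing)) +_) (trans (sumOver-map just (allFin N)) (sumOver-allFin N h))

    count-u : v ≡ u → ∑[ x ∈ parentOptions N ] 𝟙 (does (admissible? u p v x)) ≡ 𝟙 (toℕ u <ᵇ toℕ p)
    count-u refl = begin
      ∑[ x ∈ parentOptions N ] 𝟙 (does (admissible? u p u x))  ≡⟨ options ⟩
      𝟙 (does (admissible? u p u nothing)) + ∑[ w < N ] h w
        ≡⟨ cong₂ _+_ (cong 𝟙 (dec-false (admissible? u p u nothing) no-root)) (∑-single h p only-p) ⟩
      h p
        ≡⟨ cong 𝟙 (does-⇔ (mk⇔ (λ (at-u , _) → proj₂ (at-u refl)) u<p⇒) (admissible? u p u (just p)) (toℕ u <? toℕ p)) ⟩
      𝟙 (toℕ u <ᵇ toℕ p)                                        ∎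
      where
      open ≡-Reasoning
      no-root : ¬ Admissible u p u nothing
      no-root (at-u , _) with at-u refl
      ... | () , _
      only-p : ∀ w → w ≢ p → h w ≡ 0
      only-p w w≢p = cong 𝟙 (dec-false (admissible? u p u (just w)) (λ (at-u , _) → w≢p (just-injective (proj₁ (at-u refl)))))
      u<p⇒ : toℕ u < toℕ p → Admissible u p u (just p)
      u<p⇒ u<p = (λ _ → refl , u<p) , (λ u≢u → ⊥-elim (u≢u refl))

    h-< : v ≢ u → ∀ w → (w ≡ u → toℕ w < toℕ v → toℕ p < toℕ v) → h w ≡ 𝟙 (toℕ w <ᵇ toℕ v)
    h-< v≢u w extra = cong 𝟙 (does-⇔ (mk⇔ to from) (admissible? u p v (just w)) (toℕ w <? toℕ v))
      where
      to : Admissible u p v (just w) → toℕ w < toℕ v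
      to (_ , off-u) with off-u v≢u
      ... | just (w<v , _) = w<v
      from : toℕ w < toℕ v → Admissible u p v (just w)
      from w<v = (λ v≡u → ⊥-elim (v≢u v≡u)) , (λ _ → just (w<v , λ w≡u → extra w≡u w<v))

    h-u : v ≢ u → ¬ toℕ p < toℕ v → h u ≡ 0
    h-u v≢u p≮v = cong 𝟙 (dec-false (admissible? u p v (just u)) λ (_ , off-u) → p≮v (proj₂ (Maybe.drop-just (off-u v≢u)) refl))

    count-≢ : v ≢ u → ∑[ x ∈ parentOptions N ] 𝟙 (does (admissible? u p v x)) ≡ slot (toℕ u) (toℕ p) (toℕ v)
    count-≢ v≢u = trans options (trans (cong (_+ ∑[ w < N ] h w) (cong 𝟙 (dec-true (admissible? u p v nothing) root))) count-below)
      where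
      root : Admissible u p v nothing
      root = (λ v≡u → ⊥-elim (v≢u v≡u)) , (λ _ → nothing)
      all-below : (∀ w → w ≡ u → toℕ w < toℕ v → toℕ p < toℕ v) → ∑[ w < N ] h w ≡ toℕ v
      all-below extra = trans (sum-cong-≗ (λ w → h-< v≢u w (extra w))) (count-< (toℕ v) (<⇒≤ (toℕ<n v)))
      count-below : suc (∑[ w < N ] h w) ≡ slot (toℕ u) (toℕ p) (toℕ v)
      count-below with toℕ p <? toℕ v | toℕ u <? toℕ v
      ... | yes p<v | _       = trans (cong suc (all-below (λ _ _ _ → p<v))) (sym (slot-> p<v))
      ... | no  _   | no  v≮u =
        trans (cong suc (all-below (λ { w refl u<v → ⊥-elim (v≮u u<v) }))) (sym (slot-≤ (≮⇒≥ v≮u)))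
      ... | no  p≮v | yes u<v = begin
        suc (∑[ w < N ] h w)                  ≡⟨ cong (λ b → 𝟙 b + ∑[ w < N ] h w) (<ᵇ-true u<v) ⟨
        𝟙 (toℕ u <ᵇ toℕ v) + ∑[ w < N ] h w   ≡⟨ ∑-exchange h (λ w → 𝟙 (toℕ w <ᵇ toℕ v)) u agree ⟩
        h u + ∑[ w < N ] 𝟙 (toℕ w <ᵇ toℕ v)   ≡⟨ cong₂ _+_ (h-u v≢u p≮v) (count-< (toℕ v) (<⇒≤ (toℕ<n v))) ⟩
        toℕ v                                 ≡⟨ slot-inside u<v (≮⇒≥ p≮v) ⟨
        slot (toℕ u) (toℕ p) (toℕ v)          ∎
        where
        open ≡-Reasoning
        agree : ∀ w → w ≢ u → h w ≡ 𝟙 (toℕ w <ᵇ toℕ v)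
        agree w w≢u = h-< v≢u w (λ w≡u → ⊥-elim (w≢u w≡u))

  count-admissible : ∑[ x ∈ parentOptions N ] 𝟙 (does (admissible? u p v x)) ≡ parentChoices (toℕ u) (toℕ p) (toℕ v)
  count-admissible with ≡⊎≢ v u
  ... | inj₁ v≡u = trans (count-u v≡u) (sym (trans (cong (parentChoices _ _) (cong toℕ v≡u)) (parentChoices-≡ (toℕ u))))
  ... | inj₂ v≢u = trans (count-≢ v≢u) (sym (parentChoices-≢ (v≢u ∘ toℕ-injective)))

nonRecordSum : ℕ → ℕ
nonRecordSum N = ∑[ u < N ] ∑[ p < N ] ∏[ v < N ] parentChoices (toℕ u) (toℕ p) (toℕ v)

R≡nonRecordSum : ∀ m → R (suc m) m ≡ nonRecordSum (suc m)
R≡nonRecordSum m = begin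
  R N m
    ≡⟨ length-filter (λ par → isForest par ∧ (records par ≡ᵇ m)) (allParentMaps N) ⟩
  ∑[ par ∈ allParentMaps N ] 𝟙 (isForest par ∧ (records par ≡ᵇ m))
    ≡⟨ sumOver-cong (allParentMaps N) 𝟙-records≡∑soleIndicator ⟩
  ∑[ par ∈ allParentMaps N ] ∑[ u < N ] ∑[ p < N ] soleIndicator par u p
    ≡⟨ sumOver-∑-comm (allParentMaps N) (λ par u → ∑[ p < N ] soleIndicator par u p) ⟩
  ∑[ u < N ] ∑[ par ∈ allParentMaps N ] ∑[ p < N ] soleIndicator par u p
    ≡⟨ sum-cong-≗ {N} (λ u → sumOver-∑-comm (allParentMaps N) (λ par p → soleIndicator par u p)) ⟩
  ∑[ u < N ] ∑[ p < N ] ∑[ par ∈ allParentMaps N ] ∏[ v < N ] 𝟙 (does (admissible? u p v (lookup par v)))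
    ≡⟨ sum-cong-≗ {N} (λ u → sum-cong-≗ {N} (λ p →
         sumOver-allVecs-∏ (parentOptions N) N (λ v x → 𝟙 (does (admissible? u p v x))))) ⟩
  ∑[ u < N ] ∑[ p < N ] ∏[ v < N ] ∑[ x ∈ parentOptions N ] 𝟙 (does (admissible? u p v x))
    ≡⟨ sum-cong-≗ {N} (λ u → sum-cong-≗ {N} (λ p → ∏-cong (count-admissible u p))) ⟩
  nonRecordSum N
    ∎
  where
  open ≡-Reasoning
  N = suc m

∏-parentChoices : ∀ {u P} K → u < P → u ≤ K → K ≤ P → ∏[ v < suc K ] parentChoices u P (toℕ v) ≡ K !
∏-parentChoices {u} {P} K u<P u≤K K≤P with m≤n⇒m<n∨m≡n u≤K
... | inj₂ refl = begin
  ∏[ v < suc u ] parentChoices u P (toℕ v)            ≡⟨ ∏-toℕ-last u (parentChoices u P) ⟩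
  ∏[ v < u ] parentChoices u P (toℕ v) * parentChoices u P u
    ≡⟨ cong₂ _*_ (∏-cong below) (trans (parentChoices-≡ u) (cong 𝟙 (<ᵇ-true u<P))) ⟩
  ∏[ v < u ] suc (toℕ v) * 1                           ≡⟨ *-identityʳ _ ⟩
  ∏[ v < u ] suc (toℕ v)                               ≡⟨ ∏-suc u ⟩
  u !                                                  ∎
  where
  open ≡-Reasoning
  below : (v : Fin u) → parentChoices u P (toℕ v) ≡ suc (toℕ v)
  below v = trans (parentChoices-≢ (<⇒≢ (toℕ<n v))) (slot-≤ (<⇒≤ (toℕ<n v)))
∏-parentChoices {u} {P} (suc K) u<P _ K<P | inj₁ u<K = begin
  ∏[ v < suc (suc K) ] parentChoices u P (toℕ v)              ≡⟨ ∏-toℕ-last (suc K) (parentChoices u P) ⟩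
  ∏[ v < suc K ] parentChoices u P (toℕ v) * parentChoices u P (suc K)
    ≡⟨ cong₂ _*_ (∏-parentChoices K u<P (s≤s⁻¹ u<K) (<⇒≤ K<P))
                 (trans (parentChoices-≢ {u} {P} (>⇒≢ u<K)) (slot-inside {u} {P} u<K K<P)) ⟩
  K ! * suc K                                                 ≡⟨ *-comm (K !) (suc K) ⟩
  suc K !                                                     ∎
  where open ≡-Reasoning

nonRecordSum-suc : ∀ N → nonRecordSum (suc N) ≡ suc N * nonRecordSum N + N * N !
nonRecordSum-suc N = begin
  ∑[ u < suc N ] row (suc N) (toℕ u)                  ≡⟨ ∑-toℕ-last N (row (suc N)) ⟩
  ∑[ u < N ] row (suc N) (toℕ u) + row (suc N) N
    ≡⟨ cong₂ _+_ (sum-cong-≗ {N} (λ u → row-old (toℕ u) (toℕ<n u))) row-new ⟩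
  ∑[ u < N ] (suc N * row N (toℕ u) + N !) + 0        ≡⟨ +-identityʳ _ ⟩
  ∑[ u < N ] (suc N * row N (toℕ u) + N !)            ≡⟨ ∑-distrib-+ {N} (λ u → suc N * row N (toℕ u)) (λ _ → N !) ⟩
  ∑[ u < N ] (suc N * row N (toℕ u)) + ∑[ u < N ] (N !)
    ≡⟨ cong₂ _+_ (sym (*-distribˡ-sum {N} (suc N) (row N ∘ toℕ))) (∑-const N (N !)) ⟩
  suc N * nonRecordSum N + N * N !                    ∎
  where
  open ≡-Reasoning
  Q : ℕ → ℕ → ℕ → ℕ
  Q K u p = ∏[ v < K ] parentChoices u p (toℕ v)
  row : ℕ → ℕ → ℕ
  row K u = ∑[ p < K ] Q K u (toℕ p)
  row-old : ∀ u → u < N → row (suc N) u ≡ suc N * row N u + N !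
  row-old u u<N = begin
    ∑[ p < suc N ] Q (suc N) u (toℕ p)            ≡⟨ ∑-toℕ-last N (Q (suc N) u) ⟩
    ∑[ p < N ] Q (suc N) u (toℕ p) + Q (suc N) u N
      ≡⟨ cong₂ _+_ (sum-cong-≗ {N} (λ p → trans (∏-toℕ-last N (parentChoices u (toℕ p))) (cong (Q N u (toℕ p) *_) (last p))))
                   (∏-parentChoices N u<N (<⇒≤ u<N) ≤-refl) ⟩
    ∑[ p < N ] (Q N u (toℕ p) * suc N) + N !      ≡⟨ cong (_+ N !) (*-distribʳ-sum {N} (suc N) (Q N u ∘ toℕ)) ⟨
    row N u * suc N + N !                         ≡⟨ cong (_+ N !) (*-comm (row N u) (suc N)) ⟩
    suc N * row N u + N !                         ∎
    where
    last : (p : Fin N) → parentChoices u (toℕ p) N ≡ suc N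
    last p = trans (parentChoices-≢ (>⇒≢ u<N)) (slot-> (toℕ<n p))
  row-new : row (suc N) N ≡ 0
  row-new = ∑-zero (λ p → Q (suc N) N (toℕ p)) (λ p →
    trans (∏-toℕ-last N (parentChoices N (toℕ p))) (trans (cong (Q N N (toℕ p) *_) (last p)) (*-zeroʳ (Q N N (toℕ p)))))
    where
    last : (p : Fin (suc N)) → parentChoices N (toℕ p) N ≡ 0
    last p = trans (parentChoices-≡ N) (cong 𝟙 (<ᵇ-false (s≤s⁻¹ (toℕ<n p))))

nonRecordSum≡weightRec : ∀ N → nonRecordSum N ≡ weightRec N
nonRecordSum≡weightRec zero    = refl
nonRecordSum≡weightRec (suc N) = trans (nonRecordSum-suc N) (cong (λ t → suc N * t + N * N !) (nonRecordSum≡weightRec N))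

proposition2p7 : (n : ℕ) → 1 ≤ n → R n (n ∸ 1) ≡ W n
proposition2p7 (suc m) _ = begin
  R (suc m) m           ≡⟨ R≡nonRecordSum m ⟩
  nonRecordSum (suc m)  ≡⟨ nonRecordSum≡weightRec (suc m) ⟩
  weightRec (suc m)     ≡⟨ W≡weightRec (suc m) ⟨
  W (suc m)             ∎
  where open ≡-Reasoning
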